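{- For all $n \ge 1$, $$|S_n(132, 3241, 54123)| = F_{n+8} - \binom{n+1}{4} - 3 \binom{n+1}{3} - 4 \binom{n+1}{2} - 9 \binom{n+1}{1} - 11,$$ and $$\sum_{n=0}^\infty |S_n(132, 3241, 54123)| x^n = \frac{1 - 5x+10x^2-8x^3+x^4+4x^5-2x^6}{(1-x)^5 (1-x-x^2)}.$$
   Context: $S_n$ is the set of permutations of $\{1,\dots,n\}$ in one-line notation; $\pi$ avoids $\sigma\in S_k$ if no subsequence of $\pi$ of length $k$ has the same relative order as $\sigma$; $S_n(R)$ is the set of $\pi\in S_n$ avoiding every element of $R$, and $S_0(R)$ contains only the empty permutation. $F_n$ denotes the Fibonacci numbers, $F_0=0$, $F_1=1$, $F_n=F_{n-1}+F_{n-2}$. (The permutation $54123$ is the paper's $\mu_{2,3}$.) -}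

module Defs where

open import Data.Bool using (Bool; true; false; _∧_; not; if_then_else_)
open import Data.Nat using (ℕ; zero; suc; _+_; _<ᵇ_; _≡ᵇ_; _∸_)
open import Data.Integer as ℤ using (ℤ)
open import Data.List using (List; []; _∷_; map; concatMap; length; zipWith; upTo)
open import Data.Bool.ListAction using (all; any)
open import Data.Bool.Properties using (_≟_)
open import Relation.Nullary.Decidable using (does)

filterᵇ : {A : Set} → (A → Bool) → List A → List A
filterᵇ p [] = []
filterᵇ p (x ∷ xs) = if p x then x ∷ filterᵇ p xs else filterᵇ p xs

F : ℕ → ℕ
F zero = zero
F (suc zero) = suc zero
F (suc (suc n)) = F (suc n) + F n

-- Permutations in one-line notation, as lists of naturals.

oneTo : ℕ → List ℕ
oneTo n = map suc (upTo n)

words : ℕ → List ℕ → List (List ℕ)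
words zero A = [] ∷ []
words (suc k) A = concatMap (λ a → map (a ∷_) (words k A)) A

occ : ℕ → List ℕ → ℕ
occ a [] = 0
occ a (b ∷ w) = if a ≡ᵇ b then suc (occ a w) else occ a w

isPerm : ℕ → List ℕ → Bool
isPerm n w = all (λ i → occ i w ≡ᵇ 1) (oneTo n)

S : ℕ → List (List ℕ)
S n = filterᵇ (isPerm n) (words n (oneTo n))

subseqs : List ℕ → List (List ℕ)
subseqs [] = [] ∷ []
subseqs (a ∷ w) = let r = subseqs w in map (a ∷_) r Data.List.++ r

-- u and v have the same length and the same relative order
-- (for lists with distinct entries: u_i < u_j iff v_i < v_j for all i < j)
sameOrder : List ℕ → List ℕ → Bool
sameOrder [] [] = true
sameOrder [] (_ ∷ _) = false
sameOrder (_ ∷ _) [] = false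
sameOrder (a ∷ u) (b ∷ v) =
  all (λ b' → b') (zipWith (λ x y → does ((a <ᵇ x) ≟ (b <ᵇ y))) u v)
  ∧ sameOrder u v

contains : List ℕ → List ℕ → Bool
contains π σ = any (sameOrder σ) (subseqs π)

avoidsAll : List (List ℕ) → List ℕ → Bool
avoidsAll R π = all (λ σ → not (contains π σ)) R

Sav : ℕ → List (List ℕ) → List (List ℕ)
Sav n R = filterᵇ (avoidsAll R) (S n)

-- Formal power series with integer coefficients as coefficient
-- sequences ℕ → ℤ; polynomials as coefficient lists [c0, c1, ...].

Poly : Set
Poly = List ℤ

coeff : Poly → ℕ → ℤ
coeff [] k = ℤ.+ 0
coeff (c ∷ p) zero = c
coeff (c ∷ p) (suc k) = coeff p k

polyAdd : Poly → Poly → Poly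
polyAdd [] q = q
polyAdd (c ∷ p) [] = c ∷ p
polyAdd (c ∷ p) (d ∷ q) = (c ℤ.+ d) ∷ polyAdd p q

polyMul : Poly → Poly → Poly
polyMul [] q = []
polyMul (c ∷ p) q = polyAdd (map (c ℤ.*_) q) (ℤ.+ 0 ∷ polyMul p q)

polyPow : Poly → ℕ → Poly
polyPow p zero = ℤ.+ 1 ∷ []
polyPow p (suc k) = polyMul p (polyPow p k)

sumTo : (ℕ → ℤ) → ℕ → ℤ
sumTo f zero = f 0
sumTo f (suc n) = sumTo f n ℤ.+ f (suc n)

-- coefficient of x^n in the formal power series (Σ_k a_k x^k) · p(x)
mulSeriesPoly : (ℕ → ℤ) → Poly → ℕ → ℤ
mulSeriesPoly a p n = sumTo (λ j → coeff p j ℤ.* a (n ∸ j)) n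

-- A permutation avoiding 132 whose maximum N is not its last entry has the form α N β with every entry of α
-- above every entry of β; if it also avoids 3241, α is increasing, so α = m+1, …, m+k over a permutation β of
-- 1, …, m. With N in front, avoiding 54123 becomes β avoiding 4123, and one more round of the same
-- decomposition turns avoiding 4123 into avoiding 123, where only N−1 … 1 N, N β and N−1 N β remain. This gives
-- explicit duplicate-free lists of the three classes, whose sizes satisfy a(n+1) = a(n) + Σ_{1 ≤ m ≤ n} b(m),
-- b(n+1) = b(n) + Σ_{1 ≤ m ≤ n} c(m) and c(n+3) = 1 + c(n+2) + c(n+1); the closed form follows by induction
-- with Pascal's rule. Four differences of a give c shifted by two, which E² − E − 1 sends to the constant 1, so
-- (E − 1)⁵ (E² − E − 1), the reciprocal of the denominator, annihilates a.

module Submission where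

open import Defs
open import Data.Bool using (Bool; true; false; _∧_; not; if_then_else_)
open import Data.Bool.ListAction using (all; any)
open import Data.Bool.Properties using (_≟_)
open import Data.Empty using (⊥; ⊥-elim)
open import Data.Integer as ℤ using (ℤ; +_; -_; _-_; _*_)
import Data.Integer.Properties as ℤ
open import Data.Integer.Tactic.RingSolver using (solve-∀)
open import Data.List using (List; []; _∷_; [_]; length; _++_; map; concatMap; zipWith; take; drop; upTo)
open import Data.List.Extrema.Nat using (max; max<v⁺; max≤v⁺; xs≤max)
open import Data.List.Membership.Propositional using (_∈_; _∉_; find)
open import Data.List.Membership.Propositional.Properties using (∈-map⁺; ∈-map⁻; ∈-++⁺ˡ; ∈-++⁺ʳ; ∈-++⁻; ∈-∃++; ∈-upTo⁺; ∈-upTo⁻; ∈-concatMap⁺; ∈-concatMap⁻)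
open import Data.List.Membership.Propositional.Properties.WithK using (unique∧set⇒bag)
open import Data.List.Properties using (≡-dec; ++-cancelˡ; ++-assoc; ++-identityʳ; ∷-injectiveˡ; ∷-injectiveʳ; ∷ʳ-injectiveˡ; length-++; length-map; length-upTo; take++drop≡id)
open import Data.List.Relation.Binary.BagAndSetEquality using (∼bag⇒↭)
open import Data.List.Relation.Binary.Permutation.Propositional using (_↭_; ↭⇒↭ₛ′)
open import Data.List.Relation.Binary.Permutation.Propositional.Properties using (↭-length)
open import Data.List.Relation.Binary.Pointwise using (Pointwise-≡⇒≡)
open import Data.List.Relation.Binary.Sublist.Propositional using (_⊆_; []; _∷_; _∷ʳ_; ⊆-refl; ⊆-trans; minimum; from∈)
open import Data.List.Relation.Binary.Sublist.Propositional.Properties using (++⁺; ++⁺ˡ; ++⁺ʳ; length-mono-≤; All-resp-⊆; Any-resp-⊆)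
open import Data.List.Relation.Unary.All using (All; []; _∷_)
import Data.List.Relation.Unary.All as All
import Data.List.Relation.Unary.All.Properties as AllP
open import Data.List.Relation.Unary.AllPairs using (AllPairs; []; _∷_)
import Data.List.Relation.Unary.AllPairs as AllPairs
open import Data.List.Relation.Unary.Any using (here; there)
import Data.List.Relation.Unary.Any as Any
open import Data.List.Relation.Unary.Sorted.TotalOrder.Properties using (↗↭↗⇒≋; AllPairs⇒Sorted)
open import Data.List.Relation.Unary.Unique.Propositional using (Unique)
import Data.List.Relation.Unary.Unique.Propositional.Properties as UP
open import Data.Nat using (ℕ; zero; suc; _+_; _∸_; _≤_; _<_; _≥_; _>_; _<ᵇ_; _≡ᵇ_; z≤n; s≤s; _<?_)
open import Data.Nat.Combinatorics using (_C_; nCk+nC[k+1]≡[n+1]C[k+1]; nC1≡n)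
open import Data.Nat.Induction using (<-rec)
open import Data.Nat.Properties hiding (_≟_)
open import Data.Nat.Properties using () renaming (_≟_ to _≟ℕ_)
open import Data.List.Membership.DecPropositional (≡-dec _≟ℕ_) using (_∈?_)
open import Data.Product using (_×_; _,_; proj₁; proj₂; ∃-syntax)
import Data.Product as Product
open import Data.Sum using (_⊎_; inj₁; inj₂)
open import Function using (id; _∘_; _∘′_; _⇔_; mk⇔)
open import Relation.Binary.Definitions using (tri<; tri≈; tri>)
import Relation.Binary.Construct.Flip.EqAndOrd as Flip
open import Relation.Binary.PropositionalEquality hiding ([_])
open import Relation.Nullary using (¬_; yes; no; Dec; does)

private variable A : Set

∧-true⁻ˡ : ∀ {a b} → a ∧ b ≡ true → a ≡ true
∧-true⁻ˡ {true} _ = refl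

∧-true⁻ʳ : ∀ {a b} → a ∧ b ≡ true → b ≡ true
∧-true⁻ʳ {true} h = h

∧-true⁺ : ∀ {a b} → a ≡ true → b ≡ true → a ∧ b ≡ true
∧-true⁺ refl refl = refl

∈-filterᵇ⁻ : ∀ {p : A → Bool} {x} xs → x ∈ filterᵇ p xs → x ∈ xs × p x ≡ true
∈-filterᵇ⁻ {p = p} (y ∷ xs) x∈ with p y in py
∈-filterᵇ⁻ (y ∷ xs) (here refl) | true = here refl , py
∈-filterᵇ⁻ (y ∷ xs) (there x∈) | true = Product.map₁ there (∈-filterᵇ⁻ xs x∈)
∈-filterᵇ⁻ (y ∷ xs) x∈ | false = Product.map₁ there (∈-filterᵇ⁻ xs x∈)

∈-filterᵇ⁺ : ∀ {p : A → Bool} {x} xs → x ∈ xs → p x ≡ true → x ∈ filterᵇ p xs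
∈-filterᵇ⁺ (y ∷ xs) (here refl) px rewrite px = here refl
∈-filterᵇ⁺ {p = p} (y ∷ xs) (there x∈) px with p y
... | true = there (∈-filterᵇ⁺ xs x∈ px)
... | false = ∈-filterᵇ⁺ xs x∈ px

filterᵇ-⊆ : ∀ (p : A → Bool) xs {x} → x ∈ filterᵇ p xs → x ∈ xs
filterᵇ-⊆ p xs x∈ = proj₁ (∈-filterᵇ⁻ xs x∈)

filterᵇ-Unique : ∀ {p : A → Bool} xs → Unique xs → Unique (filterᵇ p xs)
filterᵇ-Unique [] [] = []
filterᵇ-Unique {p = p} (y ∷ xs) (y∉ ∷ u) with p y
... | true = All.tabulate (All.lookup y∉ ∘ filterᵇ-⊆ p xs) ∷ filterᵇ-Unique xs u
... | false = filterᵇ-Unique xs u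

all-true⁻ : ∀ (p : A → Bool) xs → all p xs ≡ true → ∀ {x} → x ∈ xs → p x ≡ true
all-true⁻ p (y ∷ xs) h (here refl) = ∧-true⁻ˡ h
all-true⁻ p (y ∷ xs) h (there x∈) = all-true⁻ p xs (∧-true⁻ʳ {p y} h) x∈

all-true⁺ : ∀ (p : A → Bool) xs → (∀ {x} → x ∈ xs → p x ≡ true) → all p xs ≡ true
all-true⁺ p [] h = refl
all-true⁺ p (x ∷ xs) h = ∧-true⁺ (h (here refl)) (all-true⁺ p xs (h ∘ there))

any-true⁻ : ∀ (p : A → Bool) xs → any p xs ≡ true → ∃[ x ] (x ∈ xs × p x ≡ true)
any-true⁻ p (x ∷ xs) h with p x in px
... | true = x , here refl , px
... | false = Product.map₂ (Product.map₁ there) (any-true⁻ p xs h)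

any-true⁺ : ∀ (p : A → Bool) xs {x} → x ∈ xs → p x ≡ true → any p xs ≡ true
any-true⁺ p (y ∷ xs) (here refl) px rewrite px = refl
any-true⁺ p (y ∷ xs) (there x∈) px with p y
... | true = refl
... | false = any-true⁺ p xs x∈ px

Unique-length : ∀ {xs ys : List A} → Unique xs → Unique ys → (∀ {x} → x ∈ xs ⇔ x ∈ ys) →
                length xs ≡ length ys
Unique-length uxs uys xs∼ys = ↭-length (∼bag⇒↭ (unique∧set⇒bag uxs uys xs∼ys))

<⇒<ᵇ≡true : ∀ m n → m < n → (m <ᵇ n) ≡ true
<⇒<ᵇ≡true zero (suc n) _ = refl
<⇒<ᵇ≡true (suc m) (suc n) (s≤s h) = <⇒<ᵇ≡true m n h

≥⇒<ᵇ≡false : ∀ m n → n ≤ m → (m <ᵇ n) ≡ false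
≥⇒<ᵇ≡false m zero _ = refl
≥⇒<ᵇ≡false (suc m) (suc n) (s≤s h) = ≥⇒<ᵇ≡false m n h

<ᵇ≡true⇒< : ∀ m n → (m <ᵇ n) ≡ true → m < n
<ᵇ≡true⇒< zero (suc n) _ = s≤s z≤n
<ᵇ≡true⇒< (suc m) (suc n) h = s≤s (<ᵇ≡true⇒< m n h)

≡ᵇ-refl : ∀ x → (x ≡ᵇ x) ≡ true
≡ᵇ-refl zero = refl
≡ᵇ-refl (suc x) = ≡ᵇ-refl x

≢⇒≡ᵇ≡false : ∀ x y → x ≢ y → (x ≡ᵇ y) ≡ false
≢⇒≡ᵇ≡false zero zero x≢y = ⊥-elim (x≢y refl)
≢⇒≡ᵇ≡false zero (suc y) _ = refl
≢⇒≡ᵇ≡false (suc x) zero _ = refl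
≢⇒≡ᵇ≡false (suc x) (suc y) x≢y = ≢⇒≡ᵇ≡false x y (x≢y ∘ cong suc)

≡ᵇ≡true⇒≡ : ∀ x y → (x ≡ᵇ y) ≡ true → x ≡ y
≡ᵇ≡true⇒≡ zero zero _ = refl
≡ᵇ≡true⇒≡ (suc x) (suc y) h = cong suc (≡ᵇ≡true⇒≡ x y h)

occ-self : ∀ x → occ x [ x ] ≡ 1
occ-self x rewrite ≡ᵇ-refl x = refl

occ-∷ : ∀ x b w → occ x (b ∷ w) ≡ occ x [ b ] + occ x w
occ-∷ x b w with x ≡ᵇ b
... | true = refl
... | false = refl

occ-++ : ∀ x xs ys → occ x (xs ++ ys) ≡ occ x xs + occ x ys
occ-++ x [] ys = refl
occ-++ x (b ∷ xs) ys with x ≡ᵇ b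
... | true = cong suc (occ-++ x xs ys)
... | false = occ-++ x xs ys

∈⇒1≤occ : ∀ {x xs} → x ∈ xs → 1 ≤ occ x xs
∈⇒1≤occ {x} (here refl) rewrite ≡ᵇ-refl x = s≤s z≤n
∈⇒1≤occ {x} {b ∷ xs} (there x∈) with x ≡ᵇ b
... | true = s≤s z≤n
... | false = ∈⇒1≤occ x∈

1≤occ⇒∈ : ∀ x xs → 1 ≤ occ x xs → x ∈ xs
1≤occ⇒∈ x (b ∷ xs) h with x ≡ᵇ b in x≡ᵇb
... | true = here (≡ᵇ≡true⇒≡ x b x≡ᵇb)
... | false = there (1≤occ⇒∈ x xs h)

occ≡0⇒∉ : ∀ {x xs} → occ x xs ≡ 0 → x ∉ xs
occ≡0⇒∉ occ≡0 x∈ = 1+n≰n (subst (1 ≤_) occ≡0 (∈⇒1≤occ x∈))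

∉⇒occ≡0 : ∀ {x} xs → x ∉ xs → occ x xs ≡ 0
∉⇒occ≡0 {x} xs x∉ = n≤0⇒n≡0 (≮⇒≥ (x∉ ∘ 1≤occ⇒∈ x xs))

occ≤1⇒Unique : ∀ xs → (∀ x → occ x xs ≤ 1) → Unique xs
occ≤1⇒Unique [] _ = []
occ≤1⇒Unique (b ∷ xs) occ≤1 = All.tabulate b∉ ∷ occ≤1⇒Unique xs (λ x → ≤-trans (occ-tail x) (occ≤1 x))
  where
  occ-tail : ∀ x → occ x xs ≤ occ x (b ∷ xs)
  occ-tail x = subst (occ x xs ≤_) (sym (occ-∷ x b xs)) (m≤n+m _ _)
  b∉ : ∀ {z} → z ∈ xs → b ≢ z
  b∉ z∈ refl = 1+n≰n (≤-trans (s≤s (∈⇒1≤occ z∈)) (subst (_≤ 1) occ-b (occ≤1 b)))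
    where
    occ-b : occ b (b ∷ xs) ≡ 1 + occ b xs
    occ-b = trans (occ-∷ b b xs) (cong (λ v → v + occ b xs) (occ-self b))

inRange : ℕ → ℕ → ℕ
inRange n zero = 0
inRange n (suc x) = if x <ᵇ n then 1 else 0

record IsPerm (n : ℕ) (π : List ℕ) : Set where
  constructor mkIsPerm
  field counts : ∀ x → occ x π ≡ inRange n x
open IsPerm

inRange≡1⇒ : ∀ n x → inRange n x ≡ 1 → ∃[ y ] (x ≡ suc y × y < n)
inRange≡1⇒ n (suc y) h with y <ᵇ n in y<ᵇn
... | true = y , refl , <ᵇ≡true⇒< y n y<ᵇn

inRange≡1⇒bounds : ∀ n x → inRange n x ≡ 1 → 1 ≤ x × x ≤ n
inRange≡1⇒bounds n x h with inRange≡1⇒ n x h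
... | y , refl , y<n = s≤s z≤n , y<n

inRange-in : ∀ n y → y < n → inRange n (suc y) ≡ 1
inRange-in n y y<n rewrite <⇒<ᵇ≡true y n y<n = refl

inRange-out : ∀ n y → n ≤ y → inRange n (suc y) ≡ 0
inRange-out n y n≤y rewrite ≥⇒<ᵇ≡false y n n≤y = refl

inRange-above : ∀ n x → n < x → inRange n x ≡ 0
inRange-above n (suc y) (s≤s n≤y) = inRange-out n y n≤y

inRange≤1 : ∀ n x → inRange n x ≤ 1
inRange≤1 n zero = z≤n
inRange≤1 n (suc x) with x <ᵇ n
... | true = ≤-refl
... | false = z≤n

inRange-0⊎1 : ∀ n x → inRange n x ≡ 0 ⊎ inRange n x ≡ 1
inRange-0⊎1 n zero = inj₁ refl
inRange-0⊎1 n (suc x) with x <ᵇ n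
... | true = inj₂ refl
... | false = inj₁ refl

∈-oneTo⁻ : ∀ {n x} → x ∈ oneTo n → inRange n x ≡ 1
∈-oneTo⁻ {n} x∈ with ∈-map⁻ suc x∈
... | y , y∈ , refl = inRange-in n y (∈-upTo⁻ y∈)

∈-oneTo⁺ : ∀ {n x} → inRange n x ≡ 1 → x ∈ oneTo n
∈-oneTo⁺ {n} {x} h with inRange≡1⇒ n x h
... | y , refl , y<n = ∈-map⁺ suc (∈-upTo⁺ y<n)

oneTo-Unique : ∀ n → Unique (oneTo n)
oneTo-Unique n = UP.map⁺ suc-injective (UP.upTo⁺ n)

IsPerm-∈ : ∀ {n π x} → IsPerm n π → x ∈ π → inRange n x ≡ 1
IsPerm-∈ {n} {π} {x} perm x∈ with inRange-0⊎1 n x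
... | inj₂ ≡1 = ≡1
... | inj₁ ≡0 = ⊥-elim (occ≡0⇒∉ (trans (counts perm x) ≡0) x∈)

IsPerm-bounds : ∀ {n π y} → IsPerm n π → y ∈ π → 1 ≤ y × y ≤ n
IsPerm-bounds {n} {y = y} perm y∈ = inRange≡1⇒bounds n y (IsPerm-∈ perm y∈)

IsPerm-Unique : ∀ {n π} → IsPerm n π → Unique π
IsPerm-Unique {n} {π} perm = occ≤1⇒Unique π (λ x → subst (_≤ 1) (sym (counts perm x)) (inRange≤1 n x))

IsPerm-length : ∀ {n π} → IsPerm n π → length π ≡ n
IsPerm-length {n} {π} perm = begin
    length π
  ≡⟨ Unique-length (IsPerm-Unique perm) (oneTo-Unique n) (mk⇔ (∈-oneTo⁺ ∘ IsPerm-∈ perm) oneTo⊆π) ⟩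
    length (map suc (upTo n))
  ≡⟨ trans (length-map suc (upTo n)) (length-upTo n) ⟩
    n ∎
  where
  open ≡-Reasoning
  oneTo⊆π : ∀ {x} → x ∈ oneTo n → x ∈ π
  oneTo⊆π {x} x∈ = 1≤occ⇒∈ x π (≤-reflexive (sym (trans (counts perm x) (∈-oneTo⁻ x∈))))

∈-words⁻ : ∀ k A w → w ∈ words k A → length w ≡ k × All (_∈ A) w
∈-words⁻ zero A .[] (here refl) = refl , []
∈-words⁻ (suc k) A w w∈ with find (∈-concatMap⁻ (λ a → map (a ∷_) (words k A)) {xs = A} w∈)
... | a , a∈ , w∈′ with ∈-map⁻ (a ∷_) w∈′
... | v , v∈ , refl = Product.map (cong suc) (a∈ ∷_) (∈-words⁻ k A v v∈)

∈-words⁺ : ∀ k A w → length w ≡ k → All (_∈ A) w → w ∈ words k A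
∈-words⁺ zero A [] refl [] = here refl
∈-words⁺ (suc k) A (a ∷ w) len (a∈ ∷ w⊆A) =
  ∈-concatMap⁺ (λ b → map (b ∷_) (words k A)) {xs = A}
    (Any.map (λ { refl → ∈-map⁺ (a ∷_) (∈-words⁺ k A w (suc-injective len) w⊆A) }) a∈)

words-Unique : ∀ k A → Unique A → Unique (words k A)
words-Unique zero A _ = [] ∷ []
words-Unique (suc k) A uA = prefixes-Unique A uA
  where
  prefixes-Unique : ∀ B → Unique B → Unique (concatMap (λ a → map (a ∷_) (words k A)) B)
  prefixes-Unique [] _ = []
  prefixes-Unique (b ∷ B) (b∉ ∷ uB) =
    UP.++⁺ (UP.map⁺ ∷-injectiveʳ (words-Unique k A uA)) (prefixes-Unique B uB) disjoint
    where
    disjoint : ∀ {w} → ¬ (w ∈ map (b ∷_) (words k A) × w ∈ concatMap (λ a → map (a ∷_) (words k A)) B)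
    disjoint (w∈b , w∈B) with ∈-map⁻ (b ∷_) w∈b | find (∈-concatMap⁻ (λ a → map (a ∷_) (words k A)) {xs = B} w∈B)
    ... | _ , _ , refl | c , c∈ , w∈c with ∈-map⁻ (c ∷_) w∈c
    ... | _ , _ , bw≡cv = All.lookup b∉ c∈ (∷-injectiveˡ bw≡cv)

S-Unique : ∀ n → Unique (S n)
S-Unique n = filterᵇ-Unique (words n (oneTo n)) (words-Unique n (oneTo n) (oneTo-Unique n))

∈-S⁻ : ∀ {n π} → π ∈ S n → IsPerm n π
∈-S⁻ {n} {π} π∈ = mkIsPerm counts′
  where
  counts′ : ∀ x → occ x π ≡ inRange n x
  counts′ x with ∈-filterᵇ⁻ (words n (oneTo n)) π∈
  ... | π∈words , once with ∈-words⁻ n (oneTo n) π π∈words | inRange-0⊎1 n x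
  ... | _ , _ | inj₂ ≡1 = trans (≡ᵇ≡true⇒≡ _ _ (all-true⁻ (λ i → occ i π ≡ᵇ 1) (oneTo n) once (∈-oneTo⁺ ≡1))) (sym ≡1)
  ... | _ , π⊆oneTo | inj₁ ≡0 = trans (∉⇒occ≡0 π (λ x∈ → 0≢1+n (trans (sym ≡0) (∈-oneTo⁻ (All.lookup π⊆oneTo x∈))))) (sym ≡0)

∈-S⁺ : ∀ {n π} → IsPerm n π → π ∈ S n
∈-S⁺ {n} {π} perm = ∈-filterᵇ⁺ (words n (oneTo n))
  (∈-words⁺ n (oneTo n) π (IsPerm-length perm) (All.tabulate (∈-oneTo⁺ ∘ IsPerm-∈ perm)))
  (all-true⁺ (λ i → occ i π ≡ᵇ 1) (oneTo n) (λ {i} i∈ → cong (_≡ᵇ 1) (trans (counts perm i) (∈-oneTo⁻ i∈))))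

⊆-split : ∀ {s} (P Q : List A) → s ⊆ P ++ Q → ∃[ s₁ ] ∃[ s₂ ] (s ≡ s₁ ++ s₂ × s₁ ⊆ P × s₂ ⊆ Q)
⊆-split [] Q s⊆ = [] , _ , refl , [] , s⊆
⊆-split (x ∷ P) Q (.x ∷ʳ s⊆) with ⊆-split P Q s⊆
... | s₁ , s₂ , refl , s₁⊆ , s₂⊆ = s₁ , s₂ , refl , x ∷ʳ s₁⊆ , s₂⊆
⊆-split (x ∷ P) Q (refl ∷ s⊆) with ⊆-split P Q s⊆
... | s₁ , s₂ , refl , s₁⊆ , s₂⊆ = x ∷ s₁ , s₂ , refl , refl ∷ s₁⊆ , s₂⊆

AllPairs-resp-⊆ : ∀ {R : A → A → Set} {s π : List A} → s ⊆ π → AllPairs R π → AllPairs R s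
AllPairs-resp-⊆ [] [] = []
AllPairs-resp-⊆ (_ ∷ʳ s⊆) (_ ∷ rπ) = AllPairs-resp-⊆ s⊆ rπ
AllPairs-resp-⊆ (refl ∷ s⊆) (r ∷ rπ) = All-resp-⊆ s⊆ r ∷ AllPairs-resp-⊆ s⊆ rπ

∈-subseqs⁻ : ∀ π {s} → s ∈ subseqs π → s ⊆ π
∈-subseqs⁻ [] (here refl) = []
∈-subseqs⁻ (a ∷ π) s∈ with ∈-++⁻ (map (a ∷_) (subseqs π)) s∈
... | inj₂ s∈′ = a ∷ʳ ∈-subseqs⁻ π s∈′
... | inj₁ s∈′ with ∈-map⁻ (a ∷_) s∈′
... | _ , s∈″ , refl = refl ∷ ∈-subseqs⁻ π s∈″

∈-subseqs⁺ : ∀ {s π} → s ⊆ π → s ∈ subseqs π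
∈-subseqs⁺ [] = here refl
∈-subseqs⁺ {π = a ∷ π} (_ ∷ʳ s⊆) = ∈-++⁺ʳ (map (a ∷_) (subseqs π)) (∈-subseqs⁺ s⊆)
∈-subseqs⁺ {π = a ∷ π} (refl ∷ s⊆) = ∈-++⁺ˡ (∈-map⁺ (a ∷_) (∈-subseqs⁺ s⊆))

Occurs : List ℕ → List ℕ → Set
Occurs σ π = ∃[ s ] (s ⊆ π × sameOrder σ s ≡ true)

contains⇒Occurs : ∀ π σ → contains π σ ≡ true → Occurs σ π
contains⇒Occurs π σ h with any-true⁻ (sameOrder σ) (subseqs π) h
... | s , s∈ , order = s , ∈-subseqs⁻ π s∈ , order

Occurs⇒contains : ∀ π σ → Occurs σ π → contains π σ ≡ true
Occurs⇒contains π σ (s , s⊆ , order) = any-true⁺ (sameOrder σ) (subseqs π) (∈-subseqs⁺ s⊆) order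

Occurs-mono : ∀ {σ π′ π} → π′ ⊆ π → Occurs σ π′ → Occurs σ π
Occurs-mono π′⊆ (s , s⊆ , order) = s , ⊆-trans s⊆ π′⊆ , order

headAgrees : ℕ → ℕ → List ℕ → List ℕ → Bool
headAgrees a x σ s = all id (zipWith (λ u v → does ((a <ᵇ u) ≟ (x <ᵇ v))) σ s)

sameOrder-∷⁻ : ∀ a x σ s → sameOrder (a ∷ σ) (x ∷ s) ≡ true → headAgrees a x σ s ≡ true × sameOrder σ s ≡ true
sameOrder-∷⁻ a x σ s order = ∧-true⁻ˡ order , ∧-true⁻ʳ {headAgrees a x σ s} order

sameOrder-length : ∀ σ s → sameOrder σ s ≡ true → length σ ≡ length s
sameOrder-length [] [] _ = refl
sameOrder-length (a ∷ σ) (x ∷ s) order = cong suc (sameOrder-length σ s (proj₂ (sameOrder-∷⁻ a x σ s order)))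

Occurs-length : ∀ {σ π} → Occurs σ π → length σ ≤ length π
Occurs-length {σ} (s , s⊆ , order) = subst (_≤ _) (sym (sameOrder-length σ s order)) (length-mono-≤ s⊆)

does-refl : ∀ b → does (b ≟ b) ≡ true
does-refl true = refl
does-refl false = refl

zipWith-++ : ∀ {A B C : Set} (f : A → B → C) u₁ u₂ v₁ v₂ → length u₁ ≡ length v₁ →
             zipWith f (u₁ ++ u₂) (v₁ ++ v₂) ≡ zipWith f u₁ v₁ ++ zipWith f u₂ v₂
zipWith-++ f [] u₂ [] v₂ _ = refl
zipWith-++ f (x ∷ u₁) u₂ (y ∷ v₁) v₂ len = cong (f x y ∷_) (zipWith-++ f u₁ u₂ v₁ v₂ (suc-injective len))

all-++⁻ : ∀ (p : A → Bool) xs ys → all p (xs ++ ys) ≡ true → all p xs ≡ true × all p ys ≡ true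
all-++⁻ p [] ys h = refl , h
all-++⁻ p (x ∷ xs) ys h = Product.map₁ (∧-true⁺ (∧-true⁻ˡ h)) (all-++⁻ p xs ys (∧-true⁻ʳ {p x} h))

Compares : Bool → ℕ → List ℕ → Set
Compares c a = All (λ y → (a <ᵇ y) ≡ c)

compare-transfer : ∀ c a b u v → length u ≡ length v → headAgrees a b u v ≡ true →
  Compares c b v → all (λ z → does ((a <ᵇ z) ≟ c)) u ≡ true
compare-transfer c a b [] [] _ _ _ = refl
compare-transfer c a b (x ∷ u) (y ∷ v) len agree (b↝y ∷ b↝v) with a <ᵇ x | b <ᵇ y | b↝y | agree
... | true | true | refl | agree′ = compare-transfer true a b u v (suc-injective len) agree′ b↝v
... | false | false | refl | agree′ = compare-transfer false a b u v (suc-injective len) agree′ b↝v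

crossOK : Bool → ℕ → List ℕ → Bool
crossOK c zero σ = true
crossOK c (suc k) [] = true
crossOK c (suc k) (a ∷ σ) = all (λ z → does ((a <ᵇ z) ≟ c)) (drop k σ) ∧ crossOK c k σ

sameOrder-split : ∀ c σ s₁ s₂ → All (λ x → Compares c x s₂) s₁ → sameOrder σ (s₁ ++ s₂) ≡ true →
  sameOrder (take (length s₁) σ) s₁ ≡ true × sameOrder (drop (length s₁) σ) s₂ ≡ true ×
  crossOK c (length s₁) σ ≡ true
sameOrder-split c σ [] s₂ _ order = refl , order , refl
sameOrder-split c (a ∷ σ) (x ∷ s₁) s₂ (x↝s₂ ∷ s₁↝s₂) order
  with sameOrder-∷⁻ a x σ (s₁ ++ s₂) order
... | agrees , order′ with sameOrder-split c σ s₁ s₂ s₁↝s₂ order′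
... | order₁ , order₂ , cross = ∧-true⁺ (proj₁ heads) order₁ , order₂ ,
  ∧-true⁺ (compare-transfer c a x (drop k σ) s₂ (sameOrder-length (drop k σ) s₂ order₂) (proj₂ heads) x↝s₂) cross
  where
  k = length s₁
  f = λ u v → does ((a <ᵇ u) ≟ (x <ᵇ v))
  heads : headAgrees a x (take k σ) s₁ ≡ true × headAgrees a x (drop k σ) s₂ ≡ true
  heads = all-++⁻ id (zipWith f (take k σ) s₁) _
    (subst (λ w → all id w ≡ true)
           (trans (cong (λ τ → zipWith f τ (s₁ ++ s₂)) (sym (take++drop≡id k σ)))
                  (zipWith-++ f (take k σ) (drop k σ) s₁ s₂ (sameOrder-length (take k σ) s₁ order₁)))
           agrees)

pairwiseOK : Bool → List ℕ → Bool
pairwiseOK c [] = true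
pairwiseOK c (a ∷ σ) = all (λ z → does ((a <ᵇ z) ≟ c)) σ ∧ pairwiseOK c σ

sameOrder-pairwise : ∀ c σ s → AllPairs (λ x y → (x <ᵇ y) ≡ c) s → sameOrder σ s ≡ true → pairwiseOK c σ ≡ true
sameOrder-pairwise c [] [] _ _ = refl
sameOrder-pairwise c (a ∷ σ) (x ∷ s) (x↝s ∷ s↝s) order with sameOrder-∷⁻ a x σ s order
... | agrees , order′ = ∧-true⁺ (compare-transfer c a x σ s (sameOrder-length σ s order′) agrees x↝s)
                                (sameOrder-pairwise c σ s s↝s order′)

sameOrder-∷ : ∀ c a x σ s → Compares c a σ → Compares c x s → length σ ≡ length s →
  sameOrder σ s ≡ true → sameOrder (a ∷ σ) (x ∷ s) ≡ true
sameOrder-∷ c a x σ s a↝σ x↝s len order = ∧-true⁺ (agree σ s a↝σ x↝s len) order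
  where
  agree : ∀ σ s → Compares c a σ → Compares c x s → length σ ≡ length s → headAgrees a x σ s ≡ true
  agree [] [] _ _ _ = refl
  agree (z ∷ σ) (y ∷ s) (a↝z ∷ a↝σ) (x↝y ∷ x↝s) len
    rewrite a↝z | x↝y | does-refl c = agree σ s a↝σ x↝s (suc-injective len)

Occurs-∷ : ∀ c a x σ π → Compares c a σ → Compares c x π → Occurs σ π → Occurs (a ∷ σ) (x ∷ π)
Occurs-∷ c a x σ π a↝σ x↝π (s , s⊆ , order) =
  x ∷ s , refl ∷ s⊆ , sameOrder-∷ c a x σ s a↝σ (All-resp-⊆ s⊆ x↝π) (sameOrder-length σ s order) order

Occurs-split : ∀ c σ P Q → All (λ x → Compares c x Q) P → Occurs σ (P ++ Q) →
  ∃[ k ] (k ≤ length σ × Occurs (take k σ) P × Occurs (drop k σ) Q × crossOK c k σ ≡ true)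
Occurs-split c σ P Q P↝Q (s , s⊆ , order) with ⊆-split P Q s⊆
... | s₁ , s₂ , refl , s₁⊆ , s₂⊆ with sameOrder-split c σ s₁ s₂ (All.map (All-resp-⊆ s₂⊆) (All-resp-⊆ s₁⊆ P↝Q)) order
... | order₁ , order₂ , cross =
  length s₁ , k≤ , (s₁ , s₁⊆ , order₁) , (s₂ , s₂⊆ , order₂) , cross
  where
  k≤ : length s₁ ≤ length σ
  k≤ = subst (length s₁ ≤_) (sym (trans (sameOrder-length σ _ order) (length-++ s₁))) (m≤m+n _ _)

Occurs-pairwise : ∀ c σ π → AllPairs (λ x y → (x <ᵇ y) ≡ c) π → Occurs σ π → pairwiseOK c σ ≡ true
Occurs-pairwise c σ π π↝π (s , s⊆ , order) = sameOrder-pairwise c σ s (AllPairs-resp-⊆ s⊆ π↝π) order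

interval : ℕ → ℕ → List ℕ
interval m zero = []
interval m (suc k) = suc m ∷ interval (suc m) k

block : ℕ → ℕ → List ℕ → List ℕ
block m k β = interval m k ++ suc (m + k) ∷ β

descending : ℕ → List ℕ
descending zero = []
descending (suc k) = suc k ∷ descending k

inRange-suc : ∀ m x → inRange (suc m) x ≡ inRange m x + occ x [ suc m ]
inRange-suc m zero = refl
inRange-suc m (suc y) with <-cmp y m
... | tri< y<m y≢m _ rewrite <⇒<ᵇ≡true y m y<m | <⇒<ᵇ≡true y (suc m) (m≤n⇒m≤1+n y<m) | ≢⇒≡ᵇ≡false y m y≢m = refl
... | tri≈ _ refl _ rewrite ≥⇒<ᵇ≡false y y ≤-refl | <⇒<ᵇ≡true y (suc y) ≤-refl | ≡ᵇ-refl y = refl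
... | tri> _ y≢m y>m rewrite ≥⇒<ᵇ≡false y m (<⇒≤ y>m) | ≥⇒<ᵇ≡false y (suc m) y>m | ≢⇒≡ᵇ≡false y m y≢m = refl

occ-interval : ∀ m k x → occ x (interval m k) + inRange m x ≡ inRange (m + k) x
occ-interval m zero x rewrite +-identityʳ m = refl
occ-interval m (suc k) x = begin
    occ x (suc m ∷ interval (suc m) k) + inRange m x
  ≡⟨ cong (λ v → v + inRange m x) (occ-∷ x (suc m) (interval (suc m) k)) ⟩
    occ x [ suc m ] + occ x (interval (suc m) k) + inRange m x
  ≡⟨ rotate (occ x [ suc m ]) (occ x (interval (suc m) k)) (inRange m x) ⟩
    occ x (interval (suc m) k) + (inRange m x + occ x [ suc m ])
  ≡⟨ cong (_+_ (occ x (interval (suc m) k))) (sym (inRange-suc m x)) ⟩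
    occ x (interval (suc m) k) + inRange (suc m) x
  ≡⟨ occ-interval (suc m) k x ⟩
    inRange (suc m + k) x
  ≡⟨ cong (λ v → inRange v x) (sym (+-suc m k)) ⟩
    inRange (m + suc k) x ∎
  where
  open ≡-Reasoning
  rotate : ∀ a b c → a + b + c ≡ b + (c + a)
  rotate a b c rewrite +-comm c a | +-comm a b = +-assoc b a c

IsPerm-[] : IsPerm 0 []
IsPerm-[] = mkIsPerm λ { zero → refl ; (suc y) → refl }

IsPerm-snoc : ∀ {n π} → IsPerm n π → IsPerm (suc n) (π ++ suc n ∷ [])
IsPerm-snoc {n} {π} perm = mkIsPerm λ x → begin
    occ x (π ++ suc n ∷ [])
  ≡⟨ occ-++ x π (suc n ∷ []) ⟩
    occ x π + occ x [ suc n ]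
  ≡⟨ cong (λ v → v + occ x [ suc n ]) (counts perm x) ⟩
    inRange n x + occ x [ suc n ]
  ≡⟨ sym (inRange-suc n x) ⟩
    inRange (suc n) x ∎
  where open ≡-Reasoning

IsPerm-block : ∀ {m k β} → IsPerm m β → IsPerm (suc (m + k)) (block m k β)
IsPerm-block {m} {k} {β} perm = mkIsPerm λ x → begin
    occ x (interval m k ++ N ∷ β)
  ≡⟨ occ-++ x (interval m k) _ ⟩
    occ x (interval m k) + occ x (N ∷ β)
  ≡⟨ cong (_+_ (occ x (interval m k))) (trans (occ-∷ x N β) (cong (_+_ (occ x [ N ])) (counts perm x))) ⟩
    occ x (interval m k) + (occ x [ N ] + inRange m x)
  ≡⟨ swap (occ x (interval m k)) (occ x [ N ]) (inRange m x) ⟩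
    (occ x (interval m k) + inRange m x) + occ x [ N ]
  ≡⟨ cong (λ v → v + occ x [ N ]) (occ-interval m k x) ⟩
    inRange (m + k) x + occ x [ N ]
  ≡⟨ sym (inRange-suc (m + k) x) ⟩
    inRange N x ∎
  where
  open ≡-Reasoning
  N = suc (m + k)
  swap : ∀ a b c → a + (b + c) ≡ a + c + b
  swap a b c rewrite +-comm b c = sym (+-assoc a c b)

IsPerm-descending : ∀ n → IsPerm n (descending n)
IsPerm-descending zero = IsPerm-[]
IsPerm-descending (suc n) = mkIsPerm λ x → begin
    occ x (suc n ∷ descending n)
  ≡⟨ occ-∷ x (suc n) (descending n) ⟩
    occ x [ suc n ] + occ x (descending n)
  ≡⟨ cong (_+_ (occ x [ suc n ])) (counts (IsPerm-descending n) x) ⟩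
    occ x [ suc n ] + inRange n x
  ≡⟨ trans (+-comm (occ x [ suc n ]) (inRange n x)) (sym (inRange-suc n x)) ⟩
    inRange (suc n) x ∎
  where open ≡-Reasoning

∈-interval⁻ : ∀ m k {x} → x ∈ interval m k → m < x × x ≤ m + k
∈-interval⁻ m (suc k) (here refl) = ≤-refl , subst (suc m ≤_) (sym (+-suc m k)) (s≤s (m≤m+n m k))
∈-interval⁻ m (suc k) {x} (there x∈) with ∈-interval⁻ (suc m) k x∈
... | m<x , x≤ = <-trans (n<1+n m) m<x , subst (x ≤_) (sym (+-suc m k)) x≤

interval-increasing : ∀ m k N → m + k < N → AllPairs (λ x y → (x <ᵇ y) ≡ true) (interval m k ++ N ∷ [])
interval-increasing m zero N _ = [] ∷ []
interval-increasing m (suc k) N m+k<N =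
  All.tabulate above ∷ interval-increasing (suc m) k N (subst (_< N) (+-suc m k) m+k<N)
  where
  above : ∀ {x} → x ∈ interval (suc m) k ++ N ∷ [] → (suc m <ᵇ x) ≡ true
  above x∈ with ∈-++⁻ (interval (suc m) k) x∈
  ... | inj₁ x∈′ = <⇒<ᵇ≡true _ _ (proj₁ (∈-interval⁻ (suc m) k x∈′))
  ... | inj₂ (here refl) = <⇒<ᵇ≡true _ _ (≤-<-trans (subst (suc m ≤_) (sym (+-suc m k)) (s≤s (m≤m+n m k))) m+k<N)

descending-decreasing : ∀ n → AllPairs (λ x y → (x <ᵇ y) ≡ false) (descending n)
descending-decreasing zero = []
descending-decreasing (suc n) =
  All.tabulate (λ y∈ → ≥⇒<ᵇ≡false (suc n) _ (m≤n⇒m≤1+n (proj₂ (IsPerm-bounds (IsPerm-descending n) y∈))))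
  ∷ descending-decreasing n

block-above : ∀ m k β → IsPerm m β → All (λ x → Compares false x β) (interval m k ++ suc (m + k) ∷ [])
block-above m k β perm = All.tabulate λ x∈ → All.tabulate λ y∈ →
  ≥⇒<ᵇ≡false _ _ (≤-trans (proj₂ (IsPerm-bounds perm y∈)) (m≤ x∈))
  where
  m≤ : ∀ {x} → x ∈ interval m k ++ suc (m + k) ∷ [] → m ≤ x
  m≤ x∈ with ∈-++⁻ (interval m k) x∈
  ... | inj₁ x∈′ = <⇒≤ (proj₁ (∈-interval⁻ m k x∈′))
  ... | inj₂ (here refl) = m≤n⇒m≤1+n (m≤m+n m k)

below-last : ∀ n π → IsPerm n π → All (λ x → Compares true x (suc n ∷ [])) π
below-last n π perm = All.tabulate λ x∈ → <⇒<ᵇ≡true _ (suc n) (s≤s (proj₂ (IsPerm-bounds perm x∈))) ∷ []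

Avoids : List (List ℕ) → List ℕ → Set
Avoids R π = All (λ σ → ¬ Occurs σ π) R

Avoids-mono : ∀ {R π′ π} → π′ ⊆ π → Avoids R π → Avoids R π′
Avoids-mono π′⊆ = All.map λ {σ} ¬occurs → ¬occurs ∘ Occurs-mono {σ} π′⊆

Avoids-[] : ∀ R → all (λ σ → 0 <ᵇ length σ) R ≡ true → Avoids R []
Avoids-[] R nonempty = All.tabulate λ {σ} σ∈ occurs →
  1+n≰n (≤-trans (<ᵇ≡true⇒< 0 _ (all-true⁻ (λ σ → 0 <ᵇ length σ) R nonempty σ∈)) (Occurs-length {σ} occurs))

splitRefuted : Bool → (List ℕ → Bool) → (List ℕ → Bool) → List ℕ → ℕ → Bool
splitRefuted c mayP mayQ σ k = not (mayP (take k σ) ∧ crossOK c k σ ∧ mayQ (drop k σ))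

allSplitsRefuted : Bool → (List ℕ → Bool) → (List ℕ → Bool) → List ℕ → Bool
allSplitsRefuted c mayP mayQ σ = all (splitRefuted c mayP mayQ σ) (upTo (suc (length σ)))

MayOccur : (List ℕ → Bool) → List ℕ → Set
MayOccur may π = ∀ τ → Occurs τ π → may τ ≡ true

-- An occurrence of σ in P ++ Q splits into occurrences of a prefix of σ in P and the remaining suffix in Q. When
-- all of P compares to all of Q in the same way and mayP, mayQ over-approximate the patterns occurring in P and Q,
-- every split point can be ruled out by a computation on σ alone.
¬Occurs-++ : ∀ c σ {P Q mayP mayQ} → All (λ x → Compares c x Q) P → MayOccur mayP P → MayOccur mayQ Q →
  allSplitsRefuted c mayP mayQ σ ≡ true → ¬ Occurs σ (P ++ Q)
¬Occurs-++ c σ {P} {Q} {mayP} {mayQ} P↝Q P-sound Q-sound refuted occurs with Occurs-split c σ P Q P↝Q occurs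
... | k , k≤ , occursP , occursQ , cross =
  not-true (all-true⁻ (splitRefuted c mayP mayQ σ) _ refuted (∈-upTo⁺ (s≤s k≤)))
  where
  not-true : splitRefuted c mayP mayQ σ k ≢ true
  not-true rewrite P-sound (take k σ) occursP | cross | Q-sound (drop k σ) occursQ = λ ()

Avoids-++ : ∀ c R {P Q mayP mayQ} → All (λ x → Compares c x Q) P → MayOccur mayP P → MayOccur mayQ Q →
  all (allSplitsRefuted c mayP mayQ) R ≡ true → Avoids R (P ++ Q)
Avoids-++ c R {mayP = mayP} {mayQ} P↝Q P-sound Q-sound refuted = All.tabulate λ {σ} σ∈ →
  ¬Occurs-++ c σ P↝Q P-sound Q-sound (all-true⁻ (allSplitsRefuted c mayP mayQ) R refuted σ∈)

notIn : List (List ℕ) → List ℕ → Bool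
notIn R τ = not (does (τ ∈? R))

notIn-sound : ∀ R {π} → Avoids R π → MayOccur (notIn R) π
notIn-sound R avoids τ occurs with τ ∈? R
... | yes τ∈ = ⊥-elim (All.lookup avoids τ∈ occurs)
... | no _ = refl

shorterThan : ℕ → List ℕ → Bool
shorterThan L τ = length τ <ᵇ suc L

shorterThan-sound : ∀ L {π} → length π ≤ L → MayOccur (shorterThan L) π
shorterThan-sound L len≤ τ occurs = <⇒<ᵇ≡true (length τ) (suc L) (s≤s (≤-trans (Occurs-length {τ} occurs) len≤))

pairwiseOK-sound : ∀ c {π} → AllPairs (λ x y → (x <ᵇ y) ≡ c) π → MayOccur (pairwiseOK c) π
pairwiseOK-sound c π↝π τ = Occurs-pairwise c τ _ π↝π

blocks : (ℕ → List (List ℕ)) → ℕ → ℕ → List (List ℕ)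
blocks Y k zero = []
blocks Y k (suc m) = map (block (suc m) k) (Y (suc m)) ++ blocks Y (suc k) m

extend : (ℕ → List (List ℕ)) → ℕ → List (List ℕ)
extend Y zero = [] ∷ []
extend Y (suc n) = map (_++ suc n ∷ []) (extend Y n) ++ blocks Y 0 n

IsBlock : (ℕ → List (List ℕ)) → ℕ → List ℕ → Set
IsBlock Y n π = ∃[ m ] ∃[ k ] ∃[ β ] (1 ≤ m × m + k ≡ n × β ∈ Y m × π ≡ block m k β)

∈-blocks⁻ : ∀ Y k m {π} → π ∈ blocks Y k m →
  ∃[ m′ ] ∃[ k′ ] ∃[ β ] (1 ≤ m′ × m′ ≤ m × m′ + k′ ≡ m + k × β ∈ Y m′ × π ≡ block m′ k′ β)
∈-blocks⁻ Y k (suc m) π∈ with ∈-++⁻ (map (block (suc m) k) (Y (suc m))) π∈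
... | inj₁ π∈′ with ∈-map⁻ (block (suc m) k) π∈′
... | β , β∈ , refl = suc m , k , β , s≤s z≤n , ≤-refl , refl , β∈ , refl
∈-blocks⁻ Y k (suc m) π∈ | inj₂ π∈′ with ∈-blocks⁻ Y (suc k) m π∈′
... | m′ , k′ , β , 1≤m′ , m′≤m , sum≡ , β∈ , refl = m′ , k′ , β , 1≤m′ , m≤n⇒m≤1+n m′≤m , trans sum≡ (+-suc m k) , β∈ , refl

∈-blocks⁺ : ∀ Y k m {m′ k′ β} → 1 ≤ m′ → m′ + k′ ≡ m + k → m′ ≤ m → β ∈ Y m′ → block m′ k′ β ∈ blocks Y k m
∈-blocks⁺ Y k zero 1≤m′ _ m′≤0 _ = ⊥-elim (1+n≰n (≤-trans 1≤m′ m′≤0))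
∈-blocks⁺ Y k (suc m) {m′} {k′} 1≤m′ m′+k′≡ m′≤ β∈ with m≤n⇒m<n∨m≡n m′≤
... | inj₂ refl rewrite +-cancelˡ-≡ (suc m) k′ k m′+k′≡ = ∈-++⁺ˡ (∈-map⁺ (block (suc m) k) β∈)
... | inj₁ m′<  = ∈-++⁺ʳ (map (block (suc m) k) (Y (suc m)))
                         (∈-blocks⁺ Y (suc k) m 1≤m′ (trans m′+k′≡ (sym (+-suc m k))) (≤-pred m′<) β∈)

∈-extend⁻ : ∀ Y n {π} → π ∈ extend Y (suc n) →
  (∃[ π′ ] (π′ ∈ extend Y n × π ≡ π′ ++ suc n ∷ [])) ⊎ IsBlock Y n π
∈-extend⁻ Y n π∈ with ∈-++⁻ (map (_++ suc n ∷ []) (extend Y n)) π∈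
... | inj₁ π∈′ = inj₁ (∈-map⁻ (_++ suc n ∷ []) π∈′)
... | inj₂ π∈′ with ∈-blocks⁻ Y 0 n π∈′
... | m , k , β , 1≤m , _ , sum≡ , β∈ , refl = inj₂ (m , k , β , 1≤m , trans sum≡ (+-identityʳ n) , β∈ , refl)

-- Appending the new maximum to an R-avoider, or putting an increasing run and the maximum in front of an
-- R′-avoider of smaller values, creates no pattern of R; the last two hypotheses check this pattern by pattern.
extend-sound : ∀ Y R R′ → (∀ m β → β ∈ Y m → IsPerm m β × Avoids R′ β) →
  all (λ σ → 0 <ᵇ length σ) R ≡ true →
  all (allSplitsRefuted true (notIn R) (shorterThan 1)) R ≡ true →
  all (allSplitsRefuted false (pairwiseOK true) (notIn R′)) R ≡ true →
  ∀ n π → π ∈ extend Y n → IsPerm n π × Avoids R π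
extend-sound Y R R′ Y-sound nonempty _ _ zero .[] (here refl) = IsPerm-[] , Avoids-[] R nonempty
extend-sound Y R R′ Y-sound nonempty snoc-ok block-ok (suc n) π π∈ with ∈-extend⁻ Y n π∈
... | inj₁ (π′ , π′∈ , refl) =
  let perm , avoids = extend-sound Y R R′ Y-sound nonempty snoc-ok block-ok n π′ π′∈ in
  IsPerm-snoc perm ,
  Avoids-++ true R (below-last n π′ perm) (notIn-sound R avoids) (shorterThan-sound 1 ≤-refl) snoc-ok
... | inj₂ (m , k , β , _ , refl , β∈ , refl) =
  let perm , avoids = Y-sound m β β∈ in
  IsPerm-block {m} {k} {β} perm ,
  subst (Avoids R) (++-assoc (interval m k) (suc (m + k) ∷ []) β)
    (Avoids-++ false R (block-above m k β perm)
       (pairwiseOK-sound true (interval-increasing m k (suc (m + k)) ≤-refl)) (notIn-sound R′ avoids) block-ok)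

p132 p3241 p54123 p4123 p123 : List ℕ
p132 = 1 ∷ 3 ∷ 2 ∷ []
p3241 = 3 ∷ 2 ∷ 4 ∷ 1 ∷ []
p54123 = 5 ∷ 4 ∷ 1 ∷ 2 ∷ 3 ∷ []
p4123 = 4 ∷ 1 ∷ 2 ∷ 3 ∷ []
p123 = 1 ∷ 2 ∷ 3 ∷ []

patternsA patternsB patternsC : List (List ℕ)
patternsA = p132 ∷ p3241 ∷ p54123 ∷ []
patternsB = p132 ∷ p3241 ∷ p54123 ∷ p4123 ∷ []
patternsC = p132 ∷ p3241 ∷ p54123 ∷ p4123 ∷ p123 ∷ []

permsC : ℕ → List (List ℕ)
permsC zero = [] ∷ []
permsC (suc zero) = (descending 0 ++ 1 ∷ []) ∷ []
permsC (suc (suc zero)) = (descending 1 ++ 2 ∷ []) ∷ map (block 1 0) (permsC 1)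
permsC (suc (suc (suc n))) = (descending (suc (suc n)) ++ suc (suc (suc n)) ∷ []) ∷
  (map (block (suc (suc n)) 0) (permsC (suc (suc n))) ++ map (block (suc n) 1) (permsC (suc n)))

permsB permsA : ℕ → List (List ℕ)
permsB = extend permsC
permsA = extend permsB

permsC-head-sound : ∀ n → IsPerm (suc n) (descending n ++ suc n ∷ []) × Avoids patternsC (descending n ++ suc n ∷ [])
permsC-head-sound n = IsPerm-snoc (IsPerm-descending n) ,
  Avoids-++ true patternsC (below-last n (descending n) (IsPerm-descending n))
    (pairwiseOK-sound false (descending-decreasing n)) (shorterThan-sound 1 ≤-refl) refl

permsC-block-sound : ∀ m k β → k ≤ 1 → IsPerm m β → Avoids patternsC β →
  IsPerm (suc (m + k)) (block m k β) × Avoids patternsC (block m k β)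
permsC-block-sound m k β k≤1 perm avoids = IsPerm-block {m} {k} {β} perm ,
  subst (Avoids patternsC) (++-assoc (interval m k) (suc (m + k) ∷ []) β)
    (Avoids-++ false patternsC (block-above m k β perm) run-sound (notIn-sound patternsC avoids) refl)
  where
  run : List ℕ
  run = interval m k ++ suc (m + k) ∷ []
  short : ∀ k → k ≤ 1 → length (interval m k ++ suc (m + k) ∷ []) ≤ 2
  short zero _ = s≤s z≤n
  short (suc zero) _ = ≤-refl
  short (suc (suc k)) (s≤s ())
  run-sound : MayOccur (λ τ → pairwiseOK true τ ∧ shorterThan 2 τ) run
  run-sound τ occurs = ∧-true⁺ (pairwiseOK-sound true (interval-increasing m k (suc (m + k)) ≤-refl) τ occurs)
                               (shorterThan-sound 2 (short k k≤1) τ occurs)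

permsC-sound : ∀ n π → π ∈ permsC n → IsPerm n π × Avoids patternsC π
permsC-sound zero π (here refl) = IsPerm-[] , Avoids-[] patternsC refl
permsC-sound (suc zero) π (here refl) = permsC-head-sound 0
permsC-sound (suc (suc zero)) π (here refl) = permsC-head-sound 1
permsC-sound (suc (suc zero)) π (there π∈) with ∈-map⁻ (block 1 0) π∈
... | β , β∈ , refl = let perm , avoids = permsC-sound 1 β β∈ in permsC-block-sound 1 0 β z≤n perm avoids
permsC-sound (suc (suc (suc n))) π (here refl) = permsC-head-sound (suc (suc n))
permsC-sound (suc (suc (suc n))) π (there π∈) with ∈-++⁻ (map (block (suc (suc n)) 0) (permsC (suc (suc n)))) π∈
... | inj₁ π∈′ with ∈-map⁻ (block (suc (suc n)) 0) π∈′
... | β , β∈ , refl = let perm , avoids = permsC-sound (suc (suc n)) β β∈ in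
  Product.map₁ (subst (λ v → IsPerm (suc v) (block (suc (suc n)) 0 β)) (+-identityʳ (suc (suc n)))) (permsC-block-sound (suc (suc n)) 0 β z≤n perm avoids)
permsC-sound (suc (suc (suc n))) π (there π∈) | inj₂ π∈′ with ∈-map⁻ (block (suc n) 1) π∈′
... | β , β∈ , refl = let perm , avoids = permsC-sound (suc n) β β∈ in
  Product.map₁ (subst (λ v → IsPerm (suc v) (block (suc n) 1 β)) (+-comm (suc n) 1)) (permsC-block-sound (suc n) 1 β ≤-refl perm avoids)

permsB-sound : ∀ n π → π ∈ permsB n → IsPerm n π × Avoids patternsB π
permsB-sound = extend-sound permsC patternsB patternsC permsC-sound refl refl refl

permsA-sound : ∀ n π → π ∈ permsA n → IsPerm n π × Avoids patternsA π
permsA-sound = extend-sound permsB patternsA patternsB permsB-sound refl refl refl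

inRange-agree : ∀ t n x → x ≤ t → t ≤ n → inRange t x ≡ inRange n x
inRange-agree t n zero _ _ = refl
inRange-agree t n (suc y) y<t t≤n = trans (inRange-in t y y<t) (sym (inRange-in n y (≤-trans y<t t≤n)))

IsPerm-0 : ∀ {π} → IsPerm 0 π → π ≡ []
IsPerm-0 {[]} _ = refl
IsPerm-0 {a ∷ π} perm with IsPerm-bounds perm (here refl)
... | 1≤a , a≤0 = ⊥-elim (1+n≰n (≤-trans 1≤a a≤0))

IsPerm-< : ∀ {n} π → IsPerm n π → All (_< suc n) π
IsPerm-< π perm = All.tabulate (s≤s ∘ proj₂ ∘ IsPerm-bounds perm)

Unique-pair : ∀ {a b : A} {π} → Unique π → (a ∷ b ∷ []) ⊆ π → a ≢ b
Unique-pair uπ ab⊆ with AllPairs-resp-⊆ ab⊆ uπ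
... | (a≢b ∷ []) ∷ _ = a≢b

split-at-max : ∀ {n π} → IsPerm (suc n) π → ∃[ α ] ∃[ β ] (π ≡ α ++ suc n ∷ β × IsPerm n (α ++ β))
split-at-max {n} {π} perm with ∈-∃++ (1≤occ⇒∈ (suc n) π (≤-reflexive (sym (trans (counts perm (suc n)) (inRange-in (suc n) n ≤-refl)))))
... | α , β , refl = α , β , refl , mkIsPerm λ x → +-cancelʳ-≡ (occ x [ suc n ]) _ _ (counts′ x)
  where
  counts′ : ∀ x → occ x (α ++ β) + occ x [ suc n ] ≡ inRange n x + occ x [ suc n ]
  counts′ x = begin
      occ x (α ++ β) + occ x [ suc n ]
    ≡⟨ cong (λ v → v + occ x [ suc n ]) (occ-++ x α β) ⟩
      occ x α + occ x β + occ x [ suc n ]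
    ≡⟨ shift (occ x α) (occ x β) (occ x [ suc n ]) ⟩
      occ x α + (occ x [ suc n ] + occ x β)
    ≡⟨ cong (_+_ (occ x α)) (sym (occ-∷ x (suc n) β)) ⟩
      occ x α + occ x (suc n ∷ β)
    ≡⟨ sym (occ-++ x α (suc n ∷ β)) ⟩
      occ x (α ++ suc n ∷ β)
    ≡⟨ trans (counts perm x) (inRange-suc n x) ⟩
      inRange n x + occ x [ suc n ] ∎
    where
    open ≡-Reasoning
    shift : ∀ a b c → a + b + c ≡ a + (c + b)
    shift a b c rewrite +-comm c b = +-assoc a b c

AllPairs⊎violation : ∀ {R : A → A → Set} → (∀ x y → Dec (R x y)) → ∀ α →
  AllPairs R α ⊎ ∃[ a ] ∃[ b ] ((a ∷ b ∷ []) ⊆ α × ¬ R a b)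
AllPairs⊎violation R? [] = inj₁ []
AllPairs⊎violation R? (a ∷ α) with AllPairs⊎violation R? α
... | inj₂ (x , y , xy⊆ , ¬Rxy) = inj₂ (x , y , a ∷ʳ xy⊆ , ¬Rxy)
... | inj₁ Rα with All.all? (R? a) α
... | yes Raα = inj₁ (Raα ∷ Rα)
... | no ¬Raα with find (AllP.¬All⇒Any¬ (R? a) α ¬Raα)
... | y , y∈ , ¬Ray = inj₂ (a , y , refl ∷ from∈ y∈ , ¬Ray)

IsPerm-layers : ∀ {n} α β → IsPerm n (α ++ β) → All (λ a → All (_< a) β) α →
  ∃[ m ] (m ≤ n × IsPerm m β × (∀ x → occ x α + inRange m x ≡ inRange n x))
IsPerm-layers {n} α β perm β<α = t , t≤n , mkIsPerm countsβ , countsα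
  where
  t = max 0 β
  countsαβ : ∀ x → occ x α + occ x β ≡ inRange n x
  countsαβ x = trans (sym (occ-++ x α β)) (counts perm x)
  t<α : All (t <_) α
  t<α = All.tabulate λ {a} a∈ →
    max<v⁺ (proj₁ (IsPerm-bounds perm (∈-++⁺ˡ a∈))) (All.lookup β<α a∈)
  t≤n : t ≤ n
  t≤n = max≤v⁺ z≤n (All.tabulate (proj₂ ∘ IsPerm-bounds perm ∘ ∈-++⁺ʳ α))
  α-above : ∀ x → x ≤ t → occ x α ≡ 0
  α-above x x≤t = ∉⇒occ≡0 α λ x∈ → <⇒≱ (All.lookup t<α x∈) x≤t
  β-below : ∀ x → t < x → occ x β ≡ 0
  β-below x t<x = ∉⇒occ≡0 β λ x∈ → <⇒≱ t<x (All.lookup (xs≤max 0 β) x∈)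
  countsβ : ∀ x → occ x β ≡ inRange t x
  countsβ x with ≤-<-connex x t
  ... | inj₁ x≤t = trans (trans (cong (λ v → v + occ x β) (sym (α-above x x≤t))) (countsαβ x)) (sym (inRange-agree t n x x≤t t≤n))
  ... | inj₂ t<x = trans (β-below x t<x) (sym (inRange-above t x t<x))
  countsα : ∀ x → occ x α + inRange t x ≡ inRange n x
  countsα x with ≤-<-connex x t
  ... | inj₁ x≤t rewrite α-above x x≤t = inRange-agree t n x x≤t t≤n
  ... | inj₂ t<x rewrite inRange-above t x t<x = trans (cong (_+_ (occ x α)) (sym (β-below x t<x))) (countsαβ x)

same-occ⇒↭ : ∀ {xs ys} → Unique xs → Unique ys → (∀ x → occ x xs ≡ occ x ys) → xs ↭ ys
same-occ⇒↭ {xs} {ys} uxs uys same = ∼bag⇒↭ (unique∧set⇒bag uxs uys (mk⇔ (transfer same) (transfer (sym ∘ same))))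
  where
  transfer : ∀ {us vs} → (∀ x → occ x us ≡ occ x vs) → ∀ {x} → x ∈ us → x ∈ vs
  transfer {vs = vs} same {x} x∈ = 1≤occ⇒∈ x vs (subst (1 ≤_) (same x) (∈⇒1≤occ x∈))

↭-increasing⇒≡ : ∀ {xs ys} → AllPairs _<_ xs → AllPairs _<_ ys → xs ↭ ys → xs ≡ ys
↭-increasing⇒≡ xs< ys< xs↭ys = Pointwise-≡⇒≡ (↗↭↗⇒≋ ≤-totalOrder
  (AllPairs⇒Sorted ≤-totalOrder (AllPairs.map <⇒≤ xs<)) (AllPairs⇒Sorted ≤-totalOrder (AllPairs.map <⇒≤ ys<))
  (↭⇒↭ₛ′ isEquivalence xs↭ys))

↭-decreasing⇒≡ : ∀ {xs ys} → AllPairs _>_ xs → AllPairs _>_ ys → xs ↭ ys → xs ≡ ys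
↭-decreasing⇒≡ xs> ys> xs↭ys = Pointwise-≡⇒≡ (↗↭↗⇒≋ ≥-totalOrder
  (AllPairs⇒Sorted ≥-totalOrder (AllPairs.map <⇒≤ xs>)) (AllPairs⇒Sorted ≥-totalOrder (AllPairs.map <⇒≤ ys>))
  (↭⇒↭ₛ′ isEquivalence xs↭ys))
  where ≥-totalOrder = Flip.totalOrder ≤-totalOrder

interval-< : ∀ m k → AllPairs _<_ (interval m k)
interval-< m zero = []
interval-< m (suc k) = All.tabulate (proj₁ ∘ ∈-interval⁻ (suc m) k) ∷ interval-< (suc m) k

descending-> : ∀ n → AllPairs _>_ (descending n)
descending-> zero = []
descending-> (suc n) = All.tabulate (s≤s ∘ proj₂ ∘ IsPerm-bounds (IsPerm-descending n)) ∷ descending-> n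

increasing-interval : ∀ m k α → AllPairs _<_ α → (∀ x → occ x α + inRange m x ≡ inRange (m + k) x) → α ≡ interval m k
increasing-interval m k α α< countsα = ↭-increasing⇒≡ α< (interval-< m k)
  (same-occ⇒↭ (AllPairs.map <⇒≢ α<) (AllPairs.map <⇒≢ (interval-< m k))
    λ x → +-cancelʳ-≡ (inRange m x) _ _ (trans (countsα x) (sym (occ-interval m k x))))

decreasing-descending : ∀ n α → AllPairs _>_ α → IsPerm n α → α ≡ descending n
decreasing-descending n α α> perm = ↭-decreasing⇒≡ α> (descending-> n)
  (same-occ⇒↭ (AllPairs.map (≢-sym ∘ <⇒≢) α>) (AllPairs.map (≢-sym ∘ <⇒≢) (descending-> n))
    λ x → trans (counts perm x) (sym (counts (IsPerm-descending n) x)))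

132-shape : ∀ a N b → (a <ᵇ N) ≡ true → (a <ᵇ b) ≡ true → (N <ᵇ b) ≡ false → sameOrder p132 (a ∷ N ∷ b ∷ []) ≡ true
132-shape a N b a<N a<b N≮b rewrite a<N | a<b | N≮b = refl

3241-shape : ∀ a a′ N b → (a <ᵇ a′) ≡ false → (a <ᵇ N) ≡ true → (a <ᵇ b) ≡ false → (a′ <ᵇ N) ≡ true →
  (a′ <ᵇ b) ≡ false → (N <ᵇ b) ≡ false → sameOrder p3241 (a ∷ a′ ∷ N ∷ b ∷ []) ≡ true
3241-shape a a′ N b a≮a′ a<N a≮b a′<N a′≮b N≮b rewrite a≮a′ | a<N | a≮b | a′<N | a′≮b | N≮b = refl

123-shape : ∀ a a′ N → (a <ᵇ a′) ≡ true → (a <ᵇ N) ≡ true → (a′ <ᵇ N) ≡ true → sameOrder p123 (a ∷ a′ ∷ N ∷ []) ≡ true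
123-shape a a′ N a<a′ a<N a′<N rewrite a<a′ | a<N | a′<N = refl

132-avoiding-layered : ∀ {n} α β → IsPerm n (α ++ β) → ¬ Occurs p132 (α ++ suc n ∷ β) → All (λ a → All (_< a) β) α
132-avoiding-layered {n} α β perm ¬132 = All.tabulate λ a∈ → All.tabulate λ b∈ → below a∈ b∈
  where
  <N : All (_< suc n) (α ++ β)
  <N = IsPerm-< (α ++ β) perm
  below : ∀ {a b} → a ∈ α → b ∈ β → b < a
  below {a} {b} a∈ b∈ with a <? b
  ... | no a≮b = ≤∧≢⇒< (≮⇒≥ a≮b) (≢-sym (Unique-pair (IsPerm-Unique perm) (++⁺ (from∈ a∈) (from∈ b∈))))
  ... | yes a<b = ⊥-elim (¬132 (_ , ++⁺ (from∈ a∈) (refl ∷ from∈ b∈) ,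
    132-shape a (suc n) b (<⇒<ᵇ≡true _ _ (All.lookup <N (∈-++⁺ˡ a∈))) (<⇒<ᵇ≡true _ _ a<b)
                          (≥⇒<ᵇ≡false _ _ (<⇒≤ (All.lookup <N (∈-++⁺ʳ α b∈))))))

3241-avoiding-increasing : ∀ {n} α b β → IsPerm n (α ++ b ∷ β) → All (λ a → All (_< a) (b ∷ β)) α →
  ¬ Occurs p3241 (α ++ suc n ∷ b ∷ β) → AllPairs _<_ α
3241-avoiding-increasing {n} α b β perm β<α ¬3241 with AllPairs⊎violation _<?_ α
... | inj₁ α< = α<
... | inj₂ (a , a′ , aa′⊆ , a≮a′) = ⊥-elim (¬3241 (_ , ++⁺ aa′⊆ (refl ∷ refl ∷ minimum β) ,
  3241-shape a a′ (suc n) b (≥⇒<ᵇ≡false _ _ (≮⇒≥ a≮a′)) (<⇒<ᵇ≡true _ _ (<N a∈)) (≥⇒<ᵇ≡false _ _ (<⇒≤ (b<  a∈)))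
             (<⇒<ᵇ≡true _ _ (<N a′∈)) (≥⇒<ᵇ≡false _ _ (<⇒≤ (b< a′∈)))
             (≥⇒<ᵇ≡false _ _ (<⇒≤ (All.lookup (IsPerm-< (α ++ b ∷ β) perm) (∈-++⁺ʳ α (here refl)))))))
  where
  a∈ = Any-resp-⊆ aa′⊆ (here refl)
  a′∈ = Any-resp-⊆ aa′⊆ (there (here refl))
  <N : ∀ {x} → x ∈ α → x < suc n
  <N = All.lookup (IsPerm-< (α ++ b ∷ β) perm) ∘ ∈-++⁺ˡ
  b< : ∀ {x} → x ∈ α → b < x
  b< x∈ = All.lookup (All.lookup β<α x∈) (here refl)

BlockDecomposition : ℕ → List ℕ → List ℕ → Set
BlockDecomposition n α β = ∃[ m ] ∃[ k ] (1 ≤ m × m + k ≡ n × IsPerm m β × α ≡ interval m k)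

block-decomposition : ∀ {n} α b β → IsPerm n (α ++ b ∷ β) →
  ¬ Occurs p132 (α ++ suc n ∷ b ∷ β) → ¬ Occurs p3241 (α ++ suc n ∷ b ∷ β) → BlockDecomposition n α (b ∷ β)
block-decomposition {n} α b β perm ¬132 ¬3241 with IsPerm-layers α (b ∷ β) perm (132-avoiding-layered α (b ∷ β) perm ¬132)
... | m , m≤n , permβ , countsα =
  m , n ∸ m , 1≤m , m+[n∸m]≡n m≤n , permβ ,
  increasing-interval m (n ∸ m) α (3241-avoiding-increasing α b β perm (132-avoiding-layered α (b ∷ β) perm ¬132) ¬3241)
    (λ x → subst (λ v → occ x α + inRange m x ≡ inRange v x) (sym (m+[n∸m]≡n m≤n)) (countsα x))
  where
  1≤m : 1 ≤ m
  1≤m = subst (1 ≤_) (IsPerm-length permβ) (s≤s z≤n)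

¬Occurs-tail : ∀ {a τ N β} → Compares false a τ → Compares false N β → ¬ Occurs (a ∷ τ) (N ∷ β) → ¬ Occurs τ β
¬Occurs-tail {a} {τ} {N} {β} a↝τ N↝β ¬occurs = ¬occurs ∘ Occurs-∷ false a N τ β a↝τ N↝β

extend-complete : ∀ Y R R′ → (∀ m β → IsPerm m β → Avoids R′ β → β ∈ Y m) → p132 ∈ R → p3241 ∈ R →
  (∀ N β → Compares false N β → Avoids R (N ∷ β) → Avoids R′ β) →
  ∀ n π → IsPerm n π → Avoids R π → π ∈ extend Y n
extend-complete Y R R′ Y-complete 132∈ 3241∈ derive zero π perm _ = here (IsPerm-0 perm)
extend-complete Y R R′ Y-complete 132∈ 3241∈ derive (suc n) π perm avoids with split-at-max {n} {π} perm
... | α , [] , refl , permα rewrite ++-identityʳ α =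
  ∈-++⁺ˡ (∈-map⁺ (_++ suc n ∷ []) (extend-complete Y R R′ Y-complete 132∈ 3241∈ derive n α permα
                                   (Avoids-mono (++⁺ʳ (suc n ∷ []) ⊆-refl) avoids)))
... | α , b ∷ β , refl , permαβ =
  block-case (block-decomposition α b β permαβ (All.lookup avoids 132∈) (All.lookup avoids 3241∈))
  where
  block-case : BlockDecomposition n α (b ∷ β) → α ++ suc n ∷ b ∷ β ∈ extend Y (suc n)
  block-case (m , k , 1≤m , refl , permβ , refl) =
    ∈-++⁺ʳ (map (_++ suc (m + k) ∷ []) (extend Y (m + k)))
      (∈-blocks⁺ Y 0 (m + k) 1≤m (sym (+-identityʳ (m + k))) (m≤m+n m k) (Y-complete m (b ∷ β) permβ avoidsβ))
    where
    N↝β : Compares false (suc (m + k)) (b ∷ β)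
    N↝β = All.map (λ {y} y<N → ≥⇒<ᵇ≡false (suc (m + k)) y (<⇒≤ y<N))
            (All.tabulate (All.lookup (IsPerm-< (interval m k ++ b ∷ β) permαβ) ∘ ∈-++⁺ʳ (interval m k)))
    avoidsβ : Avoids R′ (b ∷ β)
    avoidsβ = derive (suc (m + k)) (b ∷ β) N↝β (Avoids-mono (++⁺ˡ (interval m k) ⊆-refl) avoids)

avoids-patternsB : ∀ N β → Compares false N β → Avoids patternsA (N ∷ β) → Avoids patternsB β
avoids-patternsB N β N↝β avoids =
  AllP.++⁺ (Avoids-mono (N ∷ʳ ⊆-refl) avoids) (¬Occurs-tail (refl ∷ refl ∷ refl ∷ refl ∷ []) N↝β (All.lookup avoids 54123∈) ∷ [])
  where 54123∈ = there (there (here refl))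

avoids-patternsC : ∀ N β → Compares false N β → Avoids patternsB (N ∷ β) → Avoids patternsC β
avoids-patternsC N β N↝β avoids =
  AllP.++⁺ (Avoids-mono (N ∷ʳ ⊆-refl) avoids) (¬Occurs-tail (refl ∷ refl ∷ refl ∷ []) N↝β (All.lookup avoids 4123∈) ∷ [])
  where 4123∈ = there (there (there (here refl)))

¬Occurs-123 : ∀ {a a′ N π} → (a ∷ a′ ∷ N ∷ []) ⊆ π → a < a′ → a′ < N → Avoids patternsC π → ⊥
¬Occurs-123 {a} {a′} {N} sub a<a′ a′<N avoids = All.lookup avoids (there (there (there (there (here refl)))))
  (_ , sub , 123-shape a a′ N (<⇒<ᵇ≡true _ _ a<a′) (<⇒<ᵇ≡true _ _ (<-trans a<a′ a′<N)) (<⇒<ᵇ≡true _ _ a′<N))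

permsC-head-complete : ∀ n α → IsPerm n α → Avoids patternsC (α ++ suc n ∷ []) → α ++ suc n ∷ [] ∈ permsC (suc n)
permsC-head-complete n α perm avoids with AllPairs⊎violation (λ x y → y <? x) α
... | inj₁ α> rewrite decreasing-descending n α α> perm = head n
  where
  head : ∀ n → descending n ++ suc n ∷ [] ∈ permsC (suc n)
  head zero = here refl
  head (suc zero) = here refl
  head (suc (suc n)) = here refl
... | inj₂ (x , y , xy⊆ , y≮x) =
  ⊥-elim (¬Occurs-123 (++⁺ xy⊆ (refl ∷ [])) (≤∧≢⇒< (≮⇒≥ y≮x) (Unique-pair (IsPerm-Unique perm) xy⊆))
                      (All.lookup (IsPerm-< α perm) (Any-resp-⊆ xy⊆ (there (here refl)))) avoids)

block-∈-permsC : ∀ m k β → 1 ≤ m → β ∈ permsC m → Avoids patternsC (block m k β) → block m k β ∈ permsC (suc (m + k))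
block-∈-permsC (suc zero) zero β _ β∈ _ = there (∈-map⁺ (block 1 0) β∈)
block-∈-permsC (suc (suc m)) zero β _ β∈ _ =
  subst (λ v → block (suc (suc m)) 0 β ∈ permsC (suc v)) (sym (+-identityʳ (suc (suc m))))
    (there (∈-++⁺ˡ (∈-map⁺ (block (suc (suc m)) 0) β∈)))
block-∈-permsC (suc m) (suc zero) β _ β∈ _ =
  subst (λ v → block (suc m) 1 β ∈ permsC (suc v)) (+-comm 1 (suc m))
    (there (∈-++⁺ʳ (map (block (suc (suc m)) 0) (permsC (suc (suc m)))) (∈-map⁺ (block (suc m) 1) β∈)))
block-∈-permsC m (suc (suc k)) β _ _ avoids =
  ⊥-elim (¬Occurs-123 {suc m} {suc (suc m)} (refl ∷ refl ∷ ++⁺ (minimum (interval (suc (suc m)) k)) (refl ∷ minimum β)) ≤-refl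
                      a′<N avoids)
  where
  a′<N : suc (suc m) < suc (m + suc (suc k))
  a′<N = subst (λ v → suc (suc m) < suc v) (sym (trans (+-suc m (suc k)) (cong suc (+-suc m k)))) (s≤s (s≤s (s≤s (m≤m+n m k))))

permsC-complete : ∀ n π → IsPerm n π → Avoids patternsC π → π ∈ permsC n
permsC-complete = <-rec _ complete
  where
  complete : ∀ n → (∀ {m} → m < n → ∀ π → IsPerm m π → Avoids patternsC π → π ∈ permsC m) →
             ∀ π → IsPerm n π → Avoids patternsC π → π ∈ permsC n
  complete zero _ π perm _ = here (IsPerm-0 perm)
  complete (suc n) rec π perm avoids with split-at-max {n} {π} perm
  ... | α , [] , refl , permα rewrite ++-identityʳ α = permsC-head-complete n α permα avoids
  ... | α , b ∷ β , refl , permαβ =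
    block-case (block-decomposition α b β permαβ (All.lookup avoids (here refl)) (All.lookup avoids (there (here refl))))
    where
    block-case : BlockDecomposition n α (b ∷ β) → α ++ suc n ∷ b ∷ β ∈ permsC (suc n)
    block-case (m , k , 1≤m , refl , permβ , refl) = block-∈-permsC m k (b ∷ β) 1≤m
      (rec (s≤s (m≤m+n m k)) (b ∷ β) permβ (Avoids-mono (++⁺ˡ (interval m k) (_ ∷ʳ ⊆-refl)) avoids)) avoids

permsB-complete : ∀ n π → IsPerm n π → Avoids patternsB π → π ∈ permsB n
permsB-complete = extend-complete permsC patternsB patternsC permsC-complete (here refl) (there (here refl)) avoids-patternsC

permsA-complete : ∀ n π → IsPerm n π → Avoids patternsA π → π ∈ permsA n
permsA-complete = extend-complete permsB patternsA patternsB permsB-complete (here refl) (there (here refl)) avoids-patternsB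

split-unique : ∀ {N : A} α β α′ β′ → N ∉ α → N ∉ α′ → α ++ N ∷ β ≡ α′ ++ N ∷ β′ → β ≡ β′
split-unique [] β [] β′ _ _ eq = ∷-injectiveʳ eq
split-unique [] β (a′ ∷ α′) β′ _ N∉α′ eq = ⊥-elim (N∉α′ (here (∷-injectiveˡ eq)))
split-unique (a ∷ α) β [] β′ N∉α _ eq = ⊥-elim (N∉α (here (sym (∷-injectiveˡ eq))))
split-unique (a ∷ α) β (a′ ∷ α′) β′ N∉α N∉α′ eq = split-unique α β α′ β′ (N∉α ∘ there) (N∉α′ ∘ there) (∷-injectiveʳ eq)

max∉interval : ∀ m k → suc (m + k) ∉ interval m k
max∉interval m k N∈ = 1+n≰n (proj₂ (∈-interval⁻ m k N∈))

max∉IsPerm : ∀ {n π} → IsPerm n π → suc n ∉ π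
max∉IsPerm perm N∈ = 1+n≰n (proj₂ (IsPerm-bounds perm N∈))

IsPerm-size : ∀ {m m′ β} → IsPerm m β → IsPerm m′ β → m ≡ m′
IsPerm-size perm perm′ = trans (sym (IsPerm-length perm)) (IsPerm-length perm′)

block-injective : ∀ m k {β β′} → block m k β ≡ block m k β′ → β ≡ β′
block-injective m k eq = ∷-injectiveʳ (++-cancelˡ (interval m k) _ _ eq)

block-suffix : ∀ {m k β m′ k′ β′} → m + k ≡ m′ + k′ → block m k β ≡ block m′ k′ β′ → β ≡ β′
block-suffix {m} {k} {β} {m′} {k′} {β′} sum≡ eq =
  split-unique (interval m k) β (interval m′ k′) β′ (max∉interval m k)
    (subst (_∉ interval m′ k′) (cong suc (sym sum≡)) (max∉interval m′ k′))
    (trans eq (cong (λ v → interval m′ k′ ++ suc v ∷ β′) (sym sum≡)))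

snoc≢block : ∀ {n π m k β} → IsPerm n π → 1 ≤ m → m + k ≡ n → IsPerm m β → π ++ suc n ∷ [] ≢ block m k β
snoc≢block {n} {π} {m} {k} {β} permπ 1≤m sum≡ permβ eq with
  split-unique π [] (interval m k) β (max∉IsPerm permπ)
    (subst (_∉ interval m k) (cong suc sum≡) (max∉interval m k)) (trans eq (cong (λ v → interval m k ++ suc v ∷ β) sum≡))
... | refl = 1+n≰n (subst (1 ≤_) (IsPerm-size permβ IsPerm-[]) 1≤m)

IsPermFamily : (ℕ → List (List ℕ)) → Set
IsPermFamily Y = ∀ m β → β ∈ Y m → IsPerm m β

blocks-Unique : ∀ Y → IsPermFamily Y → (∀ m → Unique (Y m)) → ∀ k m → Unique (blocks Y k m)
blocks-Unique Y perms uY k zero = []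
blocks-Unique Y perms uY k (suc m) =
  UP.++⁺ (UP.map⁺ (block-injective (suc m) k) (uY (suc m))) (blocks-Unique Y perms uY (suc k) m) disjoint
  where
  disjoint : ∀ {π} → ¬ (π ∈ map (block (suc m) k) (Y (suc m)) × π ∈ blocks Y (suc k) m)
  disjoint (π∈₁ , π∈₂) with ∈-map⁻ (block (suc m) k) π∈₁ | ∈-blocks⁻ Y (suc k) m π∈₂
  ... | β , β∈ , refl | m′ , k′ , β′ , _ , m′≤m , sum≡ , β′∈ , eq
    with block-suffix (sym (trans sum≡ (+-suc m k))) eq
  ... | refl = 1+n≰n (subst (_≤ m) (IsPerm-size (perms m′ β β′∈) (perms (suc m) β β∈)) m′≤m)

extend-Unique : ∀ Y → IsPermFamily Y → (∀ m → Unique (Y m)) → IsPermFamily (extend Y) → ∀ n → Unique (extend Y n)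
extend-Unique Y perms uY extend-perms zero = [] ∷ []
extend-Unique Y perms uY extend-perms (suc n) =
  UP.++⁺ (UP.map⁺ (λ {π} {π′} → ∷ʳ-injectiveˡ π π′) (extend-Unique Y perms uY extend-perms n)) (blocks-Unique Y perms uY 0 n) disjoint
  where
  disjoint : ∀ {π} → ¬ (π ∈ map (_++ suc n ∷ []) (extend Y n) × π ∈ blocks Y 0 n)
  disjoint (π∈₁ , π∈₂) with ∈-map⁻ (_++ suc n ∷ []) π∈₁ | ∈-blocks⁻ Y 0 n π∈₂
  ... | π′ , π′∈ , refl | m , k , β , 1≤m , _ , sum≡ , β∈ , eq =
    snoc≢block (extend-perms n π′ π′∈) 1≤m (trans sum≡ (+-identityʳ n)) (perms m β β∈) eq

permsC-IsPerm : IsPermFamily permsC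
permsC-IsPerm m β β∈ = proj₁ (permsC-sound m β β∈)

permsC-Unique : ∀ n → Unique (permsC n)
permsC-Unique zero = [] ∷ []
permsC-Unique (suc zero) = [] ∷ []
permsC-Unique (suc (suc zero)) = All.tabulate head≢ ∷ UP.map⁺ (block-injective 1 0) (permsC-Unique 1)
  where
  head≢ : ∀ {π} → π ∈ map (block 1 0) (permsC 1) → descending 1 ++ 2 ∷ [] ≢ π
  head≢ π∈ with ∈-map⁻ (block 1 0) π∈
  ... | β , β∈ , refl = snoc≢block (IsPerm-descending 1) ≤-refl refl (permsC-IsPerm 1 β β∈)
permsC-Unique (suc (suc (suc n))) =
  All.tabulate head≢ ∷ UP.++⁺ (UP.map⁺ (block-injective (suc (suc n)) 0) (permsC-Unique (suc (suc n))))
                              (UP.map⁺ (block-injective (suc n) 1) (permsC-Unique (suc n))) disjoint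
  where
  head≢ : ∀ {π} → π ∈ map (block (suc (suc n)) 0) (permsC (suc (suc n))) ++ map (block (suc n) 1) (permsC (suc n)) →
          descending (suc (suc n)) ++ suc (suc (suc n)) ∷ [] ≢ π
  head≢ π∈ with ∈-++⁻ (map (block (suc (suc n)) 0) (permsC (suc (suc n)))) π∈
  ... | inj₁ π∈′ with ∈-map⁻ (block (suc (suc n)) 0) π∈′
  ... | β , β∈ , refl = snoc≢block (IsPerm-descending (suc (suc n))) (s≤s z≤n) (+-identityʳ _) (permsC-IsPerm _ β β∈)
  head≢ π∈ | inj₂ π∈′ with ∈-map⁻ (block (suc n) 1) π∈′
  ... | β , β∈ , refl = snoc≢block (IsPerm-descending (suc (suc n))) (s≤s z≤n) (+-comm (suc n) 1) (permsC-IsPerm _ β β∈)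
  disjoint : ∀ {π} → ¬ (π ∈ map (block (suc (suc n)) 0) (permsC (suc (suc n))) × π ∈ map (block (suc n) 1) (permsC (suc n)))
  disjoint (π∈₁ , π∈₂) with ∈-map⁻ (block (suc (suc n)) 0) π∈₁ | ∈-map⁻ (block (suc n) 1) π∈₂
  ... | β , β∈ , refl | β′ , β′∈ , eq with block-suffix {suc (suc n)} {0} {β} {suc n} {1} {β′} (trans (+-identityʳ _) (+-comm 1 (suc n))) eq
  ... | refl = 1+n≰n (≤-reflexive (IsPerm-size (permsC-IsPerm (suc (suc n)) β β∈) (permsC-IsPerm (suc n) β β′∈)))

permsB-Unique : ∀ n → Unique (permsB n)
permsB-Unique = extend-Unique permsC permsC-IsPerm permsC-Unique (λ n π π∈ → proj₁ (permsB-sound n π π∈))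

permsA-Unique : ∀ n → Unique (permsA n)
permsA-Unique = extend-Unique permsB (λ n π π∈ → proj₁ (permsB-sound n π π∈)) permsB-Unique (λ n π π∈ → proj₁ (permsA-sound n π π∈))

avoidsAll⇒Avoids : ∀ R π → avoidsAll R π ≡ true → Avoids R π
avoidsAll⇒Avoids R π h = All.tabulate λ {σ} σ∈ occurs →
  not-true (Occurs⇒contains π σ occurs) (all-true⁻ (λ σ → not (contains π σ)) R h σ∈)
  where
  not-true : ∀ {b} → b ≡ true → not b ≢ true
  not-true refl ()

Avoids⇒avoidsAll : ∀ R π → Avoids R π → avoidsAll R π ≡ true
Avoids⇒avoidsAll R π avoids = all-true⁺ (λ σ → not (contains π σ)) R doesNotContain
  where
  doesNotContain : ∀ {σ} → σ ∈ R → not (contains π σ) ≡ true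
  doesNotContain {σ} σ∈ with contains π σ in contains≡
  ... | true = ⊥-elim (All.lookup avoids σ∈ (contains⇒Occurs π σ contains≡))
  ... | false = refl

∈-Sav⁻ : ∀ {n R π} → π ∈ Sav n R → IsPerm n π × Avoids R π
∈-Sav⁻ {n} {R} {π} π∈ with ∈-filterᵇ⁻ (S n) π∈
... | π∈S , avoids = ∈-S⁻ π∈S , avoidsAll⇒Avoids R π avoids

∈-Sav⁺ : ∀ {n R π} → IsPerm n π → Avoids R π → π ∈ Sav n R
∈-Sav⁺ {n} {R} {π} perm avoids = ∈-filterᵇ⁺ (S n) (∈-S⁺ perm) (Avoids⇒avoidsAll R π avoids)

length-Sav-permsA : ∀ n → length (Sav n patternsA) ≡ length (permsA n)
length-Sav-permsA n = Unique-length (filterᵇ-Unique (S n) (S-Unique n)) (permsA-Unique n) (λ {π} → mk⇔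
  (λ π∈ → let perm , avoids = ∈-Sav⁻ π∈ in permsA-complete n π perm avoids)
  (λ π∈ → let perm , avoids = permsA-sound n π π∈ in ∈-Sav⁺ perm avoids))

partialSum : (ℕ → ℕ) → ℕ → ℕ
partialSum f zero = 0
partialSum f (suc n) = partialSum f n + f (suc n)

extendedCount : (ℕ → ℕ) → ℕ → ℕ
extendedCount f zero = 1
extendedCount f (suc n) = extendedCount f n + partialSum f n

countC : ℕ → ℕ
countC zero = 1
countC (suc zero) = 1
countC (suc (suc zero)) = 2
countC (suc (suc (suc n))) = 1 + (countC (suc (suc n)) + countC (suc n))

countB countA : ℕ → ℕ
countB = extendedCount countC
countA = extendedCount countB

length-blocks : ∀ Y k m → length (blocks Y k m) ≡ partialSum (length ∘ Y) m
length-blocks Y k zero = refl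
length-blocks Y k (suc m) = begin
    length (map _ (Y (suc m)) ++ blocks Y (suc k) m)
  ≡⟨ length-++ (map _ (Y (suc m))) ⟩
    length (map _ (Y (suc m))) + length (blocks Y (suc k) m)
  ≡⟨ cong₂ _+_ (length-map _ (Y (suc m))) (length-blocks Y (suc k) m) ⟩
    length (Y (suc m)) + partialSum (length ∘ Y) m
  ≡⟨ +-comm (length (Y (suc m))) _ ⟩
    partialSum (length ∘ Y) (suc m) ∎
  where open ≡-Reasoning

partialSum-cong : ∀ {f g} → (∀ n → f n ≡ g n) → ∀ n → partialSum f n ≡ partialSum g n
partialSum-cong f≗g zero = refl
partialSum-cong f≗g (suc n) = cong₂ _+_ (partialSum-cong f≗g n) (f≗g (suc n))

length-extend : ∀ Y {f} → (∀ m → length (Y m) ≡ f m) → ∀ n → length (extend Y n) ≡ extendedCount f n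
length-extend Y hY zero = refl
length-extend Y hY (suc n) = begin
    length (map (_++ suc n ∷ []) (extend Y n) ++ blocks Y 0 n)
  ≡⟨ length-++ (map (_++ suc n ∷ []) (extend Y n)) ⟩
    length (map (_++ suc n ∷ []) (extend Y n)) + length (blocks Y 0 n)
  ≡⟨ cong₂ _+_ (trans (length-map _ (extend Y n)) (length-extend Y hY n))
               (trans (length-blocks Y 0 n) (partialSum-cong hY n)) ⟩
    extendedCount _ (suc n) ∎
  where open ≡-Reasoning

length-permsC : ∀ n → length (permsC n) ≡ countC n
length-permsC zero = refl
length-permsC (suc zero) = refl
length-permsC (suc (suc zero)) = refl
length-permsC (suc (suc (suc n))) = cong suc (begin
    length (map _ (permsC (suc (suc n))) ++ map _ (permsC (suc n)))
  ≡⟨ length-++ (map _ (permsC (suc (suc n)))) ⟩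
    length (map _ (permsC (suc (suc n)))) + length (map _ (permsC (suc n)))
  ≡⟨ cong₂ _+_ (trans (length-map _ (permsC (suc (suc n)))) (length-permsC (suc (suc n))))
               (trans (length-map _ (permsC (suc n))) (length-permsC (suc n))) ⟩
    countC (suc (suc n)) + countC (suc n) ∎)
  where open ≡-Reasoning

length-permsA : ∀ n → length (permsA n) ≡ countA n
length-permsA = length-extend permsB (length-extend permsC length-permsC)

pascal : ∀ n k → suc n C suc k ≡ n C k + n C suc k
pascal n k = sym (nCk+nC[k+1]≡[n+1]C[k+1] n k)

countC-closed : ∀ n → + countC (suc n) ≡ + F (3 + n) - + 1
countC-closed zero = refl
countC-closed (suc zero) = refl
countC-closed (suc (suc n)) =
  trans (cong₂ (λ x y → + 1 ℤ.+ (x ℤ.+ y)) (countC-closed (suc n)) (countC-closed n))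
        (ring (+ F (4 + n)) (+ F (3 + n)))
  where
  ring : ∀ x y → + 1 ℤ.+ ((x - + 1) ℤ.+ (y - + 1)) ≡ (x ℤ.+ y) - + 1
  ring = solve-∀

sumC-closed : ∀ n → + partialSum countC n ≡ + F (4 + n) - + n - + 3
sumC-closed zero = refl
sumC-closed (suc n) =
  trans (cong₂ ℤ._+_ (sumC-closed n) (countC-closed n))
        (ring (+ F (4 + n)) (+ F (3 + n)) (+ n))
  where
  ring : ∀ x y m → (x - m - + 3) ℤ.+ (y - + 1) ≡ (x ℤ.+ y) - (+ 1 ℤ.+ m) - + 3
  ring = solve-∀

countB-closed : ∀ n → + countB n ≡ + F (5 + n) - + (suc n C 2) - + 2 * + n - + 4
countB-closed zero = refl
countB-closed (suc n) rewrite pascal (suc n) 1 | nC1≡n (suc n) =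
  trans (cong₂ ℤ._+_ (countB-closed n) (sumC-closed n))
        (ring (+ F (5 + n)) (+ F (4 + n)) (+ (suc n C 2)) (+ n))
  where
  ring : ∀ x y c₂ m → (x - c₂ - + 2 * m - + 4) ℤ.+ (y - m - + 3)
                    ≡ (x ℤ.+ y) - ((+ 1 ℤ.+ m) ℤ.+ c₂) - + 2 * (+ 1 ℤ.+ m) - + 4
  ring = solve-∀

sumB-closed : ∀ n → + partialSum countB n ≡ + F (7 + n) - + (suc n C 3) - + 3 * + (suc n C 2) - + 4 * + n - + 13
sumB-closed zero = refl
sumB-closed (suc n) rewrite pascal (suc n) 2 | pascal (suc n) 1 | nC1≡n (suc n) =
  trans (cong₂ ℤ._+_ (sumB-closed n) (cong₂ ℤ._+_ (countB-closed n) (sumC-closed n)))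
        (ring (+ F (7 + n)) (+ F (5 + n)) (+ F (4 + n)) (+ (suc n C 3)) (+ (suc n C 2)) (+ n))
  where
  ring : ∀ x y z c₃ c₂ m → (x - c₃ - + 3 * c₂ - + 4 * m - + 13) ℤ.+ ((y - c₂ - + 2 * m - + 4) ℤ.+ (z - m - + 3))
                         ≡ (x ℤ.+ (y ℤ.+ z)) - (c₂ ℤ.+ c₃) - + 3 * ((+ 1 ℤ.+ m) ℤ.+ c₂) - + 4 * (+ 1 ℤ.+ m) - + 13
  ring = solve-∀

countA-closed : ∀ n → + countA n ≡ + F (8 + n) - + (suc n C 4) - + 3 * + (suc n C 3) - + 4 * + (suc n C 2)
                                   - + 9 * + suc n - + 11
countA-closed zero = refl
countA-closed (suc n) rewrite pascal (suc n) 3 | pascal (suc n) 2 | pascal (suc n) 1 | nC1≡n (suc n) =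
  trans (cong₂ ℤ._+_ (countA-closed n) (sumB-closed n))
        (ring (+ F (8 + n)) (+ F (7 + n)) (+ (suc n C 4)) (+ (suc n C 3)) (+ (suc n C 2)) (+ n))
  where
  ring : ∀ x y c₄ c₃ c₂ m → (x - c₄ - + 3 * c₃ - + 4 * c₂ - + 9 * (+ 1 ℤ.+ m) - + 11) ℤ.+ (y - c₃ - + 3 * c₂ - + 4 * m - + 13)
                          ≡ (x ℤ.+ y) - (c₃ ℤ.+ c₄) - + 3 * (c₂ ℤ.+ c₃) - + 4 * ((+ 1 ℤ.+ m) ℤ.+ c₂) - + 9 * (+ 2 ℤ.+ m) - + 11
  ring = solve-∀

-- (p ⟦ f ⟧) n = Σᵢ pᵢ · f (n + i): the polynomial p in the shift operator E, applied to the sequence f.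
_⟦_⟧ : Poly → (ℕ → ℤ) → ℕ → ℤ
([] ⟦ f ⟧) n = + 0
((c ∷ p) ⟦ f ⟧) n = c * f n ℤ.+ (p ⟦ f ⟧) (suc n)

⟦⟧-cong : ∀ p {f g} → (∀ n → f n ≡ g n) → ∀ n → (p ⟦ f ⟧) n ≡ (p ⟦ g ⟧) n
⟦⟧-cong [] f≗g n = refl
⟦⟧-cong (c ∷ p) f≗g n = cong₂ (λ x y → c * x ℤ.+ y) (f≗g n) (⟦⟧-cong p f≗g (suc n))

⟦⟧-polyAdd : ∀ p q f n → (polyAdd p q ⟦ f ⟧) n ≡ (p ⟦ f ⟧) n ℤ.+ (q ⟦ f ⟧) n
⟦⟧-polyAdd [] q f n = sym (ℤ.+-identityˡ _)
⟦⟧-polyAdd (c ∷ p) [] f n = sym (ℤ.+-identityʳ _)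
⟦⟧-polyAdd (c ∷ p) (d ∷ q) f n =
  trans (cong (λ s → (c ℤ.+ d) * f n ℤ.+ s) (⟦⟧-polyAdd p q f (suc n))) (ring c d (f n) _ _)
  where
  ring : ∀ c d x u v → (c ℤ.+ d) * x ℤ.+ (u ℤ.+ v) ≡ (c * x ℤ.+ u) ℤ.+ (d * x ℤ.+ v)
  ring = solve-∀

⟦⟧-scale : ∀ c p f n → (map (c *_) p ⟦ f ⟧) n ≡ c * (p ⟦ f ⟧) n
⟦⟧-scale c [] f n = sym (ℤ.*-zeroʳ c)
⟦⟧-scale c (d ∷ p) f n =
  trans (cong (λ s → c * d * f n ℤ.+ s) (⟦⟧-scale c p f (suc n))) (ring c d (f n) _)
  where
  ring : ∀ c d x u → c * d * x ℤ.+ c * u ≡ c * (d * x ℤ.+ u)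
  ring = solve-∀

⟦⟧-polyMul : ∀ p q f n → (polyMul p q ⟦ f ⟧) n ≡ (p ⟦ q ⟦ f ⟧ ⟧) n
⟦⟧-polyMul [] q f n = refl
⟦⟧-polyMul (c ∷ p) q f n = begin
    (polyAdd (map (c *_) q) (+ 0 ∷ polyMul p q) ⟦ f ⟧) n
  ≡⟨ ⟦⟧-polyAdd (map (c *_) q) _ f n ⟩
    (map (c *_) q ⟦ f ⟧) n ℤ.+ (+ 0 ℤ.+ (polyMul p q ⟦ f ⟧) (suc n))
  ≡⟨ cong₂ ℤ._+_ (⟦⟧-scale c q f n) (ℤ.+-identityˡ _) ⟩
    c * (q ⟦ f ⟧) n ℤ.+ (polyMul p q ⟦ f ⟧) (suc n)
  ≡⟨ cong (λ s → c * (q ⟦ f ⟧) n ℤ.+ s) (⟦⟧-polyMul p q f (suc n)) ⟩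
    ((c ∷ p) ⟦ q ⟦ f ⟧ ⟧) n ∎
  where open ≡-Reasoning

⟦1⟧ : ∀ f n → ((+ 1 ∷ []) ⟦ f ⟧) n ≡ f n
⟦1⟧ f n = ring (f n)
  where
  ring : ∀ x → + 1 * x ℤ.+ + 0 ≡ x
  ring = solve-∀

E-1 E²-E-1 : Poly
E-1 = - + 1 ∷ + 1 ∷ []
E²-E-1 = - + 1 ∷ - + 1 ∷ + 1 ∷ []

denominator numerator annihilator : Poly
denominator = polyMul (polyPow (+ 1 ∷ - + 1 ∷ []) 5) (+ 1 ∷ - + 1 ∷ - + 1 ∷ [])
numerator = + 1 ∷ - + 5 ∷ + 10 ∷ - + 8 ∷ + 1 ∷ + 4 ∷ - + 2 ∷ []
annihilator = polyMul E-1 (polyMul E²-E-1 (polyPow E-1 4))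

E-1-increment : ∀ (g h : ℕ → ℕ) → (∀ n → g (suc n) ≡ g n + h n) → ∀ n → (E-1 ⟦ +_ ∘′ g ⟧) n ≡ + h n
E-1-increment g h step n =
  trans (cong (λ v → - + 1 * + g n ℤ.+ (+ 1 * + v ℤ.+ + 0)) (step n)) (ring (+ g n) (+ h n))
  where
  ring : ∀ x y → - + 1 * x ℤ.+ (+ 1 * (x ℤ.+ y) ℤ.+ + 0) ≡ y
  ring = solve-∀

E²-E-1-countC : ∀ n → (E²-E-1 ⟦ (λ k → + countC (2 + k)) ⟧) n ≡ + 1
E²-E-1-countC n = ring (+ countC (2 + n)) (+ countC (3 + n))
  where
  ring : ∀ x y → - + 1 * x ℤ.+ (- + 1 * y ℤ.+ (+ 1 * (+ 1 ℤ.+ (y ℤ.+ x)) ℤ.+ + 0)) ≡ + 1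
  ring = solve-∀

fourthDifference-countA : ∀ n → (polyPow E-1 4 ⟦ +_ ∘′ countA ⟧) n ≡ + countC (2 + n)
fourthDifference-countA =
  next 3 (partialSum countC ∘′ suc) (countC ∘′ suc ∘′ suc)
    (next 2 (countB ∘′ suc) (partialSum countC ∘′ suc)
      (next 1 (partialSum countB) (countB ∘′ suc)
        (next 0 countA (partialSum countB) (⟦1⟧ (+_ ∘′ countA)) λ _ → refl)
        λ _ → refl)
      λ _ → refl)
    λ _ → refl
  where
  next : ∀ k (g h : ℕ → ℕ) → (∀ n → (polyPow E-1 k ⟦ +_ ∘′ countA ⟧) n ≡ + g n) →
         (∀ n → g (suc n) ≡ g n + h n) → ∀ n → (polyPow E-1 (suc k) ⟦ +_ ∘′ countA ⟧) n ≡ + h n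
  next k g h hk step n = trans (⟦⟧-polyMul E-1 (polyPow E-1 k) (+_ ∘′ countA) n)
                               (trans (⟦⟧-cong E-1 hk n) (E-1-increment g h step n))

countA-annihilated : ∀ m → (annihilator ⟦ +_ ∘′ countA ⟧) m ≡ + 0
countA-annihilated m = begin
    (annihilator ⟦ +_ ∘′ countA ⟧) m
  ≡⟨ ⟦⟧-polyMul E-1 (polyMul E²-E-1 (polyPow E-1 4)) (+_ ∘′ countA) m ⟩
    (E-1 ⟦ polyMul E²-E-1 (polyPow E-1 4) ⟦ +_ ∘′ countA ⟧ ⟧) m
  ≡⟨ ⟦⟧-cong E-1 constantOne m ⟩
    (E-1 ⟦ (λ _ → + 1) ⟧) m
  ≡⟨⟩
    + 0 ∎
  where
  open ≡-Reasoning
  constantOne : ∀ n → (polyMul E²-E-1 (polyPow E-1 4) ⟦ +_ ∘′ countA ⟧) n ≡ + 1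
  constantOne n = trans (⟦⟧-polyMul E²-E-1 (polyPow E-1 4) (+_ ∘′ countA) n)
                        (trans (⟦⟧-cong E²-E-1 fourthDifference-countA n) (E²-E-1-countC n))

sumTo-cong : ∀ {f g} n → (∀ j → f j ≡ g j) → sumTo f n ≡ sumTo g n
sumTo-cong zero f≗g = f≗g 0
sumTo-cong (suc n) f≗g = cong₂ ℤ._+_ (sumTo-cong n f≗g) (f≗g (suc n))

sumTo-stable : ∀ {f} k → (∀ j → f (suc k + j) ≡ + 0) → ∀ m → sumTo f (k + m) ≡ sumTo f k
sumTo-stable {f} k tail zero = cong (sumTo f) (+-identityʳ k)
sumTo-stable {f} k tail (suc m) = begin
    sumTo f (k + suc m)
  ≡⟨ cong (sumTo f) (+-suc k m) ⟩
    sumTo f (k + m) ℤ.+ f (suc (k + m))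
  ≡⟨ cong₂ ℤ._+_ (sumTo-stable k tail m) (tail m) ⟩
    sumTo f k ℤ.+ + 0
  ≡⟨ ℤ.+-identityʳ _ ⟩
    sumTo f k ∎
  where open ≡-Reasoning

-- From n = 7 on, the coefficient of xⁿ involves a (n − 7), …, a n with the coefficients of the denominator in
-- reverse order.
mulSeriesPoly-reciprocal : ∀ a m →
  mulSeriesPoly a denominator (7 + m) ≡ (annihilator ⟦ a ⟧) m
mulSeriesPoly-reciprocal a m =
  trans (sumTo-stable 7 (λ _ → refl) m)
        (reverse (a m) (a (1 + m)) (a (2 + m)) (a (3 + m)) (a (4 + m)) (a (5 + m)) (a (6 + m)) (a (7 + m)))
  where
  reverse : ∀ x₀ x₁ x₂ x₃ x₄ x₅ x₆ x₇ →
    + 1 * x₇ ℤ.+ - + 6 * x₆ ℤ.+ + 14 * x₅ ℤ.+ - + 15 * x₄ ℤ.+ + 5 * x₃ ℤ.+ + 4 * x₂ ℤ.+ - + 4 * x₁ ℤ.+ + 1 * x₀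
    ≡ + 1 * x₀ ℤ.+ (- + 4 * x₁ ℤ.+ (+ 4 * x₂ ℤ.+ (+ 5 * x₃ ℤ.+ (- + 15 * x₄ ℤ.+ (+ 14 * x₅ ℤ.+ (- + 6 * x₆
      ℤ.+ (+ 1 * x₇ ℤ.+ + 0)))))))
  reverse = solve-∀

countA-series : ∀ n → mulSeriesPoly (+_ ∘′ countA) denominator n ≡ coeff numerator n
countA-series 0 = refl
countA-series 1 = refl
countA-series 2 = refl
countA-series 3 = refl
countA-series 4 = refl
countA-series 5 = refl
countA-series 6 = refl
countA-series (suc (suc (suc (suc (suc (suc (suc m))))))) =
  trans (mulSeriesPoly-reciprocal (+_ ∘′ countA) m) (countA-annihilated m)

length-Sav : ∀ n → length (Sav n patternsA) ≡ countA n
length-Sav n = trans (length-Sav-permsA n) (length-permsA n)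

-- No lower bound on n is needed.
Sav-closed : ∀ n → + length (Sav n patternsA) ≡ + F (n + 8) - + ((n + 1) C 4) - + 3 * + ((n + 1) C 3)
                                                 - + 4 * + ((n + 1) C 2) - + 9 * + ((n + 1) C 1) - + 11
Sav-closed n rewrite length-Sav n | +-comm n 8 | +-comm n 1 | nC1≡n (suc n) = countA-closed n

Sav-series : ∀ n → mulSeriesPoly (λ m → + length (Sav m patternsA)) denominator n ≡ coeff numerator n
Sav-series n = trans (sumTo-cong n λ j → cong (λ v → coeff denominator j * + v) (length-Sav (n ∸ j))) (countA-series n)

mainTheorem17 :
  ((n : ℕ) → n ≥ 1 →
    + length (Sav n ((1 ∷ 3 ∷ 2 ∷ []) ∷ (3 ∷ 2 ∷ 4 ∷ 1 ∷ []) ∷ (5 ∷ 4 ∷ 1 ∷ 2 ∷ 3 ∷ []) ∷ []))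
      ≡ + F (n + 8) - + ((n + 1) C 4) - + 3 * + ((n + 1) C 3) - + 4 * + ((n + 1) C 2)
        - + 9 * + ((n + 1) C 1) - + 11)
  ×
  ((n : ℕ) →
    mulSeriesPoly
      (λ m → + length (Sav m ((1 ∷ 3 ∷ 2 ∷ []) ∷ (3 ∷ 2 ∷ 4 ∷ 1 ∷ []) ∷ (5 ∷ 4 ∷ 1 ∷ 2 ∷ 3 ∷ []) ∷ [])))
      (polyMul (polyPow (+ 1 ∷ - + 1 ∷ []) 5) (+ 1 ∷ - + 1 ∷ - + 1 ∷ []))
      n
    ≡ coeff (+ 1 ∷ - + 5 ∷ + 10 ∷ - + 8 ∷ + 1 ∷ + 4 ∷ - + 2 ∷ []) n)
mainTheorem17 = (λ n _ → Sav-closed n) , Sav-series
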